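{- Let $A$ be a commutative ring and $\varphi:L\to L'$ an isogeny of lattices (free abelian groups of finite rank) whose degree $\deg\varphi=\#(L'/\varphi(L))$ is invertible in $A$. Then the induced $A$-algebra homomorphism $\varphi_R:R(L)\to R(L')$ is an isomorphism.
   Context: An isogeny is an injective homomorphism with finite cokernel. For a lattice $L$, $R(L)$ is the completion of the group ring $A[L]$ at its augmentation ideal; $\varphi_R$ is induced by $\delta_\ell\mapsto\delta_{\varphi(\ell)}$ on group rings. -}

module Defs where

open import Level using (_⊔_)
open import Algebra.Bundles using (CommutativeRing)
open import Data.Nat as ℕ using (ℕ; zero; suc)
open import Data.Integer as ℤ using (ℤ)
open import Data.Vec as Vec using (Vec; lookup)
open import Data.Vec.Properties using (≡-dec)
open import Data.Vec.Relation.Unary.All as VAll using ()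
open import Data.Fin using (Fin)
open import Data.List as List using (List; []; _∷_; _++_)
open import Data.List.Relation.Unary.All as LAll using ()
open import Data.Product using (Σ; _×_; _,_; proj₁; proj₂)
open import Relation.Binary.PropositionalEquality using (_≡_)
open import Relation.Nullary using (does)
open import Data.Bool using (if_then_else_)

-- Lattices: a free abelian group of finite rank n is modelled as ℤ^n
-- (every such group is isomorphic to ℤ^n, and all constructions below
-- are functorial / invariant under isomorphism).

Lat : ℕ → Set
Lat n = Vec ℤ n

_⊕_ : ∀ {n} → Lat n → Lat n → Lat n
_⊕_ = Vec.zipWith ℤ._+_

IsHom : ∀ {n m} → (Lat n → Lat m) → Set
IsHom φ = ∀ u v → φ (u ⊕ v) ≡ φ u ⊕ φ v

IsInjective : ∀ {n m} → (Lat n → Lat m) → Set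
IsInjective φ = ∀ u v → φ u ≡ φ v → u ≡ v

-- #(L' / φ(L)) = d : there are d representatives, every element of L'
-- is congruent modulo φ(L) to one of them, and they are pairwise
-- incongruent.
CokernelCard : ∀ {n m} → (Lat n → Lat m) → ℕ → Set
CokernelCard {n} {m} φ d = Σ (Vec (Lat m) d) λ reps →
  (∀ w → Σ (Fin d) λ i → Σ (Lat n) λ u → w ≡ lookup reps i ⊕ φ u) ×
  (∀ i j u → lookup reps i ≡ lookup reps j ⊕ φ u → i ≡ j)

module GroupRing {c ℓ} (A : CommutativeRing c ℓ) where
  open CommutativeRing A renaming (Carrier to K)

  ι : ℕ → K
  ι zero = 0#
  ι (suc k) = 1# + ι k

  Invertible : K → Set (c ⊔ ℓ)
  Invertible a = Σ K λ b → b * a ≈ 1#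

  -- elements of A[ℤ^n] as finite formal sums  Σ a_i δ_{ℓ_i}
  A[_] : ℕ → Set c
  A[ n ] = List (K × Lat n)

  coeff : ∀ {n} → A[ n ] → Lat n → K
  coeff [] l = 0#
  coeff ((a , l') ∷ p) l =
    if does (≡-dec ℤ._≟_ l' l) then a + coeff p l else coeff p l

  _≋_ : ∀ {n} → A[ n ] → A[ n ] → Set ℓ
  p ≋ q = ∀ l → coeff p l ≈ coeff q l

  δ : ∀ {n} → Lat n → A[ n ]
  δ l = (1# , l) ∷ []

  oneᴳ : ∀ {n} → A[ n ]
  oneᴳ = δ (Vec.replicate _ (ℤ.+ 0))

  -ᴳ_ : ∀ {n} → A[ n ] → A[ n ]
  -ᴳ p = List.map (λ (a , l) → (- a , l)) p

  _-ᴳ_ : ∀ {n} → A[ n ] → A[ n ] → A[ n ]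
  p -ᴳ q = p ++ (-ᴳ q)

  _*ᴳ_ : ∀ {n} → A[ n ] → A[ n ] → A[ n ]
  p *ᴳ q = List.concatMap (λ (a , l) → List.map (λ (b , l') → (a * b , l ⊕ l')) q) p

  sumᴳ : ∀ {n} → List (A[ n ]) → A[ n ]
  sumᴳ = List.foldr _++_ []

  prodᴳ : ∀ {n k} → Vec (A[ n ]) k → A[ n ]
  prodᴳ = Vec.foldr _ _*ᴳ_ oneᴳ

  ε : ∀ {n} → A[ n ] → K
  ε p = List.foldr (λ (a , _) acc → a + acc) 0# p

  InI : ∀ {n} → A[ n ] → Set ℓ
  InI p = ε p ≈ 0#

  InPow : ∀ {n} → ℕ → A[ n ] → Set (c ⊔ ℓ)
  InPow {n} k x = Σ (List (A[ n ] × Vec (A[ n ]) k)) λ ts →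
    LAll.All (λ t → VAll.All InI (proj₂ t)) ts ×
    (x ≋ sumᴳ (List.map (λ (r , fs) → r *ᴳ prodᴳ fs) ts))

  -- R(ℤ^n) = lim_k A[ℤ^n]/I^k : compatible sequences of representatives
  record R (n : ℕ) : Set (c ⊔ ℓ) where
    field
      seq    : ℕ → A[ n ]
      compat : ∀ k m → k ℕ.≤ m → InPow k (seq m -ᴳ seq k)
  open R public

  _≈ᴿ_ : ∀ {n} → R n → R n → Set (c ⊔ ℓ)
  x ≈ᴿ y = ∀ k → InPow k (seq x k -ᴳ seq y k)

  push : ∀ {n m} → (Lat n → Lat m) → A[ n ] → A[ m ]
  push φ p = List.map (λ (a , l) → (a , φ l)) p

  -- φ_R(x) ≈ y in R(ℤ^m)  (φ_R acts levelwise by push φ)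
  φR[_]_≈_ : ∀ {n m} → (Lat n → Lat m) → R n → R m → Set (c ⊔ ℓ)
  φR[ φ ] x ≈ y = ∀ k → InPow k (push φ (seq x k) -ᴳ seq y k)

  -- φ_R is bijective (hence an isomorphism of A-algebras)
  φR-Injective : ∀ {n m} → (Lat n → Lat m) → Set (c ⊔ ℓ)
  φR-Injective {n} {m} φ = ∀ (x y : R n) →
    (∀ k → InPow k (push φ (seq x k) -ᴳ push φ (seq y k))) → x ≈ᴿ y

  φR-Surjective : ∀ {n m} → (Lat n → Lat m) → Set (c ⊔ ℓ)
  φR-Surjective {n} {m} φ = ∀ (y : R m) → Σ (R n) λ x → φR[ φ ] x ≈ y

module Submission where

-- Let I be the augmentation ideal and d the index of φ. Translation by w ∈ L′ permutes the d
-- cosets of φ(L), so d·w = φ(lift w) for a unique lift w ∈ L. As d is invertible in A, Newton's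
-- iteration gives δ_(lift w) a d-th root congruent to 1 mod I, modulo any Iᵏ, and it is unique
-- there because uᵈ - vᵈ = (u - v)·g with g ≡ d mod I. Sending δ_w to that root is, by uniqueness,
-- multiplicative and inverse to φ on group elements modulo Iᵏ; being I-adically continuous, it
-- inverts φ_R level by level.

open import Defs
open import Level using (_⊔_)
open import Algebra.Bundles using (AbelianGroup; CommutativeRing)
open import Data.Nat as ℕ using (ℕ; zero; suc; z≤n; s≤s; _≤_)
import Data.Nat.Properties as ℕ
open import Data.Integer as ℤ using (ℤ; +_; -[1+_]; _⊖_)
import Data.Integer.Properties as ℤ
open import Data.Sign as Sign using (Sign)
open import Data.Maybe as Maybe using (Maybe)
open import Data.Bool using (true; false; if_then_else_)
open import Data.Empty using (⊥-elim)
open import Data.Fin as Fin using (Fin)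
open import Data.Fin.Permutation as Perm using (Permutation)
open import Data.Vec as Vec using (Vec; []; _∷_; lookup)
open import Data.Vec.Properties using (≡-dec)
open import Data.Vec.Functional using (replicate)
import Data.Vec.Relation.Unary.All as VAll
import Data.Vec.Relation.Unary.All.Properties as VAll
open import Data.List as List using (List; []; _∷_; _++_)
import Data.List.Properties as List
import Data.List.Relation.Unary.All as LAll
import Data.List.Relation.Unary.All.Properties as LAll
open import Data.Product using (Σ; _×_; _,_; proj₁; proj₂)
open import Relation.Nullary using (does; yes; no; ¬_)
open import Relation.Nullary.Decidable using (dec⇒maybe)
open import Relation.Binary.Bundles using (Setoid)
open import Relation.Binary.PropositionalEquality as ≡ using (_≡_)
import Relation.Binary.Reasoning.Setoid

-- The ring solver with integer coefficients; with the ring itself as coefficient ring,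
-- normal forms would keep coefficients such as 1# - 1# and fail to compare.
module ℤ-Solver {c ℓ} (R : CommutativeRing c ℓ) where
  open CommutativeRing R
  open import Algebra.Properties.Ring ring using (-0#≈0#; -‿involutive; -‿distribˡ-*; -‿distribʳ-*; -‿+-comm)
  open import Algebra.Properties.Semiring.Mult.TCOptimised semiring using (×-homo-+; ×1-homo-*; 1+×) renaming (_×_ to _·_)
  open import Algebra.Solver.Ring.AlmostCommutativeRing using (AlmostCommutativeRing; _-Raw-AlmostCommutative⟶_; fromCommutativeRing)
  open import Relation.Binary.Reasoning.Setoid setoid

  ⟦_⟧ℤ : ℤ → Carrier
  ⟦ + n ⟧ℤ = n · 1#
  ⟦ -[1+ n ] ⟧ℤ = - (suc n · 1#)

  private
    ⊖-homo : ∀ m n → ⟦ m ⊖ n ⟧ℤ ≈ m · 1# - n · 1#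
    ⊖-homo zero zero = sym (-‿inverseʳ 0#)
    ⊖-homo zero (suc n) = sym (+-identityˡ _)
    ⊖-homo (suc m) zero = trans (sym (+-identityʳ _)) (+-congˡ (sym -0#≈0#))
    ⊖-homo (suc m) (suc n) = begin
      ⟦ suc m ⊖ suc n ⟧ℤ                ≡⟨ ≡.cong ⟦_⟧ℤ (ℤ.[1+m]⊖[1+n]≡m⊖n m n) ⟩
      ⟦ m ⊖ n ⟧ℤ                        ≈⟨ ⊖-homo m n ⟩
      m · 1# - n · 1#                   ≈⟨ shift (m · 1#) (n · 1#) ⟩
      (1# + m · 1#) - (1# + n · 1#)     ≈⟨ sym (+-cong (1+× m 1#) (-‿cong (1+× n 1#))) ⟩
      suc m · 1# - suc n · 1#           ∎
      where
      shift : ∀ a b → a - b ≈ (1# + a) - (1# + b)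
      shift a b = begin
        a - b                    ≈⟨ sym (+-identityˡ _) ⟩
        0# + (a - b)             ≈⟨ +-congʳ (sym (-‿inverseʳ 1#)) ⟩
        (1# - 1#) + (a - b)      ≈⟨ +-assoc 1# (- 1#) (a - b) ⟩
        1# + (- 1# + (a - b))    ≈⟨ +-congˡ (sym (+-assoc (- 1#) a (- b))) ⟩
        1# + ((- 1# + a) - b)    ≈⟨ +-congˡ (+-congʳ (+-comm (- 1#) a)) ⟩
        1# + ((a - 1#) - b)      ≈⟨ +-congˡ (+-assoc a (- 1#) (- b)) ⟩
        1# + (a + (- 1# - b))    ≈⟨ sym (+-assoc 1# a _) ⟩
        (1# + a) + (- 1# - b)    ≈⟨ +-congˡ (-‿+-comm 1# b) ⟩
        (1# + a) - (1# + b)      ∎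

    +-homo : ∀ i j → ⟦ i ℤ.+ j ⟧ℤ ≈ ⟦ i ⟧ℤ + ⟦ j ⟧ℤ
    +-homo (+ m) (+ n) = ×-homo-+ 1# m n
    +-homo (+ m) -[1+ n ] = ⊖-homo m (suc n)
    +-homo -[1+ m ] (+ n) = trans (⊖-homo n (suc m)) (+-comm _ _)
    +-homo -[1+ m ] -[1+ n ] = begin
      - (suc (suc (m ℕ.+ n)) · 1#)      ≡⟨ ≡.cong (λ k → - (k · 1#)) (≡.sym (ℕ.+-suc (suc m) n)) ⟩
      - ((suc m ℕ.+ suc n) · 1#)        ≈⟨ -‿cong (×-homo-+ 1# (suc m) (suc n)) ⟩
      - (suc m · 1# + suc n · 1#)       ≈⟨ sym (-‿+-comm _ _) ⟩
      - (suc m · 1#) + - (suc n · 1#)   ∎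

    -‿homo : ∀ i → ⟦ ℤ.- i ⟧ℤ ≈ - ⟦ i ⟧ℤ
    -‿homo (+ zero) = sym -0#≈0#
    -‿homo (+ suc n) = refl
    -‿homo -[1+ n ] = sym (-‿involutive _)

    signed : Sign → Carrier → Carrier
    signed Sign.+ x = x
    signed Sign.- x = - x

    signed-cong : ∀ s {x y} → x ≈ y → signed s x ≈ signed s y
    signed-cong Sign.+ p = p
    signed-cong Sign.- p = -‿cong p

    signed-* : ∀ s t x y → signed s x * signed t y ≈ signed (s Sign.* t) (x * y)
    signed-* Sign.+ Sign.+ x y = refl
    signed-* Sign.+ Sign.- x y = sym (-‿distribʳ-* x y)
    signed-* Sign.- Sign.+ x y = sym (-‿distribˡ-* x y)
    signed-* Sign.- Sign.- x y = begin
      - x * - y       ≈⟨ sym (-‿distribˡ-* x (- y)) ⟩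
      - (x * - y)     ≈⟨ -‿cong (sym (-‿distribʳ-* x y)) ⟩
      - - (x * y)     ≈⟨ -‿involutive _ ⟩
      x * y           ∎

    ⟦◃⟧ℤ : ∀ s n → ⟦ s ℤ.◃ n ⟧ℤ ≈ signed s (n · 1#)
    ⟦◃⟧ℤ Sign.+ zero = refl
    ⟦◃⟧ℤ Sign.- zero = sym -0#≈0#
    ⟦◃⟧ℤ Sign.+ (suc n) = refl
    ⟦◃⟧ℤ Sign.- (suc n) = refl

    ⟦⟧ℤ-signed : ∀ i → ⟦ i ⟧ℤ ≈ signed (ℤ.sign i) (ℤ.∣ i ∣ · 1#)
    ⟦⟧ℤ-signed (+ n) = refl
    ⟦⟧ℤ-signed -[1+ n ] = refl

    *-homo : ∀ i j → ⟦ i ℤ.* j ⟧ℤ ≈ ⟦ i ⟧ℤ * ⟦ j ⟧ℤ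
    *-homo i j = begin
      ⟦ i ℤ.* j ⟧ℤ                                   ≈⟨ ⟦◃⟧ℤ s (ℤ.∣ i ∣ ℕ.* ℤ.∣ j ∣) ⟩
      signed s ((ℤ.∣ i ∣ ℕ.* ℤ.∣ j ∣) · 1#)           ≈⟨ signed-cong s (×1-homo-* ℤ.∣ i ∣ ℤ.∣ j ∣) ⟩
      signed s ((ℤ.∣ i ∣ · 1#) * (ℤ.∣ j ∣ · 1#))      ≈⟨ sym (signed-* (ℤ.sign i) (ℤ.sign j) _ _) ⟩
      signed (ℤ.sign i) (ℤ.∣ i ∣ · 1#) * signed (ℤ.sign j) (ℤ.∣ j ∣ · 1#)
                                                     ≈⟨ sym (*-cong (⟦⟧ℤ-signed i) (⟦⟧ℤ-signed j)) ⟩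
      ⟦ i ⟧ℤ * ⟦ j ⟧ℤ                                ∎
      where
      s : Sign
      s = ℤ.sign i Sign.* ℤ.sign j

    ℛ : AlmostCommutativeRing c ℓ
    ℛ = fromCommutativeRing R

    ⟦⟧ℤ-homomorphism : ℤ.+-*-rawRing -Raw-AlmostCommutative⟶ ℛ
    ⟦⟧ℤ-homomorphism = record
      { ⟦_⟧ = ⟦_⟧ℤ ; +-homo = +-homo ; *-homo = *-homo ; -‿homo = -‿homo
      ; 0-homo = refl ; 1-homo = refl }

    ⟦⟧ℤ-≟ : ∀ i j → Maybe (⟦ i ⟧ℤ ≈ ⟦ j ⟧ℤ)
    ⟦⟧ℤ-≟ i j = Maybe.map (λ i≡j → reflexive (≡.cong ⟦_⟧ℤ i≡j)) (dec⇒maybe (i ℤ.≟ j))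

  open import Algebra.Solver.Ring ℤ.+-*-rawRing ℛ ⟦⟧ℤ-homomorphism ⟦⟧ℤ-≟ public
    using (solve; _:+_; _:*_; _:-_; :-_; _:=_; con)


0ᴸ : ∀ {n} → Lat n
0ᴸ = Vec.replicate _ (+ 0)

-ᴸ_ : ∀ {n} → Lat n → Lat n
-ᴸ_ = Vec.map (λ x → ℤ.- x)

⊕-assoc : ∀ {n} (a b c : Lat n) → (a ⊕ b) ⊕ c ≡ a ⊕ (b ⊕ c)
⊕-assoc [] [] [] = ≡.refl
⊕-assoc (x ∷ a) (y ∷ b) (z ∷ c) = ≡.cong₂ _∷_ (ℤ.+-assoc x y z) (⊕-assoc a b c)

⊕-comm : ∀ {n} (a b : Lat n) → a ⊕ b ≡ b ⊕ a
⊕-comm [] [] = ≡.refl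
⊕-comm (x ∷ a) (y ∷ b) = ≡.cong₂ _∷_ (ℤ.+-comm x y) (⊕-comm a b)

⊕-identityˡ : ∀ {n} (a : Lat n) → 0ᴸ ⊕ a ≡ a
⊕-identityˡ [] = ≡.refl
⊕-identityˡ (x ∷ a) = ≡.cong₂ _∷_ (ℤ.+-identityˡ x) (⊕-identityˡ a)

⊕-identityʳ : ∀ {n} (a : Lat n) → a ⊕ 0ᴸ ≡ a
⊕-identityʳ a = ≡.trans (⊕-comm a 0ᴸ) (⊕-identityˡ a)

⊕-inverseʳ : ∀ {n} (a : Lat n) → a ⊕ (-ᴸ a) ≡ 0ᴸ
⊕-inverseʳ [] = ≡.refl
⊕-inverseʳ (x ∷ a) = ≡.cong₂ _∷_ (ℤ.+-inverseʳ x) (⊕-inverseʳ a)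

⊕-inverseˡ : ∀ {n} (a : Lat n) → (-ᴸ a) ⊕ a ≡ 0ᴸ
⊕-inverseˡ a = ≡.trans (⊕-comm (-ᴸ a) a) (⊕-inverseʳ a)

Lat-abelianGroup : ℕ → AbelianGroup _ _
Lat-abelianGroup n = record
  { Carrier = Lat n ; _≈_ = _≡_ ; _∙_ = _⊕_ ; ε = 0ᴸ ; _⁻¹ = -ᴸ_
  ; isAbelianGroup = record
    { isGroup = record
      { isMonoid = record
        { isSemigroup = record
          { isMagma = record { isEquivalence = ≡.isEquivalence ; ∙-cong = ≡.cong₂ _⊕_ }
          ; assoc = ⊕-assoc }
        ; identity = ⊕-identityˡ , ⊕-identityʳ }
      ; inverse = ⊕-inverseˡ , ⊕-inverseʳ
      ; ⁻¹-cong = ≡.cong -ᴸ_ }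
    ; comm = ⊕-comm } }

module _ {n : ℕ} where
  open AbelianGroup (Lat-abelianGroup n) using (commutativeMonoid)
  open import Algebra.Properties.Group (AbelianGroup.group (Lat-abelianGroup n)) public
    using (∙-cancelˡ; ∙-cancelʳ)
  open import Algebra.Properties.CommutativeMonoid.Sum commutativeMonoid public
    using (sum; sum-permute; sum-replicate; ∑-distrib-+; sum-cong-≋)
  open import Algebra.Properties.CommutativeMonoid.Mult commutativeMonoid public
    using (×-distrib-+) renaming (_×_ to _·ᴸ_)

⊕-⊕-inverse : ∀ {n} (a c : Lat n) → (a ⊕ c) ⊕ (-ᴸ c) ≡ a
⊕-⊕-inverse a c = begin
  (a ⊕ c) ⊕ (-ᴸ c)     ≡⟨ ⊕-assoc a c (-ᴸ c) ⟩
  a ⊕ (c ⊕ (-ᴸ c))     ≡⟨ ≡.cong (a ⊕_) (⊕-inverseʳ c) ⟩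
  a ⊕ 0ᴸ               ≡⟨ ⊕-identityʳ a ⟩
  a                    ∎
  where open ≡.≡-Reasoning

⊕-inverse-⊕ : ∀ {n} (a c : Lat n) → (a ⊕ (-ᴸ c)) ⊕ c ≡ a
⊕-inverse-⊕ a c = begin
  (a ⊕ (-ᴸ c)) ⊕ c     ≡⟨ ⊕-assoc a (-ᴸ c) c ⟩
  a ⊕ ((-ᴸ c) ⊕ c)     ≡⟨ ≡.cong (a ⊕_) (⊕-inverseˡ c) ⟩
  a ⊕ 0ᴸ               ≡⟨ ⊕-identityʳ a ⟩
  a                    ∎
  where open ≡.≡-Reasoning

a⊕c≡w⇒a≡w⊕-c : ∀ {n} {a c w : Lat n} → a ⊕ c ≡ w → a ≡ w ⊕ (-ᴸ c)
a⊕c≡w⇒a≡w⊕-c {a = a} {c} ≡.refl = ≡.sym (⊕-⊕-inverse a c)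

a≡w⊕-c⇒a⊕c≡w : ∀ {n} {a c w : Lat n} → a ≡ w ⊕ (-ᴸ c) → a ⊕ c ≡ w
a≡w⊕-c⇒a⊕c≡w {c = c} {w} ≡.refl = ⊕-inverse-⊕ w c

module IsHomProperties {n m} (φ : Lat n → Lat m) (hom : IsHom φ) where
  open ≡.≡-Reasoning

  φ-0ᴸ : φ 0ᴸ ≡ 0ᴸ
  φ-0ᴸ = ∙-cancelˡ (φ 0ᴸ) (φ 0ᴸ) 0ᴸ (begin
    φ 0ᴸ ⊕ φ 0ᴸ     ≡⟨ ≡.sym (hom 0ᴸ 0ᴸ) ⟩
    φ (0ᴸ ⊕ 0ᴸ)     ≡⟨ ≡.cong φ (⊕-identityˡ 0ᴸ) ⟩
    φ 0ᴸ            ≡⟨ ≡.sym (⊕-identityʳ (φ 0ᴸ)) ⟩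
    φ 0ᴸ ⊕ 0ᴸ       ∎)

  φ-·ᴸ : ∀ d u → φ (d ·ᴸ u) ≡ d ·ᴸ φ u
  φ-·ᴸ zero u = φ-0ᴸ
  φ-·ᴸ (suc d) u = ≡.trans (hom u (d ·ᴸ u)) (≡.cong (φ u ⊕_) (φ-·ᴸ d u))

  φ-sum : ∀ {d} (f : Fin d → Lat n) → φ (sum f) ≡ sum (λ i → φ (f i))
  φ-sum {zero} f = φ-0ᴸ
  φ-sum {suc d} f = ≡.trans (hom _ _) (≡.cong (φ (f Fin.zero) ⊕_) (φ-sum (λ i → f (Fin.suc i))))

module CosetCounting {n m} (φ : Lat n → Lat m) (hom : IsHom φ) {d : ℕ} (cc : CokernelCard φ d) where
  open IsHomProperties φ hom
  open ≡.≡-Reasoning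

  _∼_ : Lat m → Lat m → Set
  a ∼ b = Σ (Lat n) λ u → a ≡ b ⊕ φ u

  ∼-reflexive : ∀ {a b} → a ≡ b → a ∼ b
  ∼-reflexive {a} ≡.refl = 0ᴸ , ≡.sym (≡.trans (≡.cong (a ⊕_) φ-0ᴸ) (⊕-identityʳ a))

  ∼-trans : ∀ {a b c} → a ∼ b → b ∼ c → a ∼ c
  ∼-trans {a} {b} {c} (u , a≡b+φu) (v , b≡c+φv) = v ⊕ u , (begin
    a                  ≡⟨ a≡b+φu ⟩
    b ⊕ φ u            ≡⟨ ≡.cong (_⊕ φ u) b≡c+φv ⟩
    (c ⊕ φ v) ⊕ φ u    ≡⟨ ⊕-assoc c (φ v) (φ u) ⟩
    c ⊕ (φ v ⊕ φ u)    ≡⟨ ≡.cong (c ⊕_) (≡.sym (hom v u)) ⟩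
    c ⊕ φ (v ⊕ u)      ∎)

  ∼-⊕ʳ : ∀ {a b} x → a ∼ b → (a ⊕ x) ∼ (b ⊕ x)
  ∼-⊕ʳ {a} {b} x (u , a≡b+φu) = u , (begin
    a ⊕ x              ≡⟨ ≡.cong (_⊕ x) a≡b+φu ⟩
    (b ⊕ φ u) ⊕ x      ≡⟨ ⊕-assoc b (φ u) x ⟩
    b ⊕ (φ u ⊕ x)      ≡⟨ ≡.cong (b ⊕_) (⊕-comm (φ u) x) ⟩
    b ⊕ (x ⊕ φ u)      ≡⟨ ≡.sym (⊕-assoc b x (φ u)) ⟩
    (b ⊕ x) ⊕ φ u      ∎)

  rep : Fin d → Lat m
  rep = lookup (proj₁ cc)

  class : Lat m → Fin d
  class a = proj₁ (proj₁ (proj₂ cc) a)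

  ∼-rep-class : ∀ a → a ∼ rep (class a)
  ∼-rep-class a = proj₂ (proj₁ (proj₂ cc) a)

  class-unique : ∀ {i j} → rep i ∼ rep j → i ≡ j
  class-unique {i} {j} (u , e) = proj₂ (proj₂ cc) i j u e

  translate : Lat m → Fin d → Fin d
  translate w i = class (rep i ⊕ w)

  translate-inverse : ∀ w i → translate (-ᴸ w) (translate w i) ≡ i
  translate-inverse w i = ≡.sym (class-unique (
    ∼-trans (∼-reflexive (≡.sym (⊕-⊕-inverse (rep i) w)))
      (∼-trans (∼-⊕ʳ (-ᴸ w) (∼-rep-class (rep i ⊕ w))) (∼-rep-class _))))

  translate-inverse′ : ∀ w j → translate w (translate (-ᴸ w) j) ≡ j
  translate-inverse′ w j = ≡.sym (class-unique (
    ∼-trans (∼-reflexive (≡.sym (⊕-inverse-⊕ (rep j) w)))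
      (∼-trans (∼-⊕ʳ w (∼-rep-class (rep j ⊕ (-ᴸ w)))) (∼-rep-class _))))

  translation : Lat m → Permutation d d
  translation w = Perm.permutation (translate w) (translate (-ᴸ w))
    (translate-inverse′ w) (translate-inverse w)

  -- Translation by w permutes the cosets; summing  rep i ⊕ w ∼ rep (translate w i)  over i
  -- and cancelling  ∑ rep  leaves  d ·ᴸ w  in the image.
  index·ᴸ-∈-image : ∀ w → Σ (Lat n) λ u → φ u ≡ d ·ᴸ w
  index·ᴸ-∈-image w = u , ≡.sym (∙-cancelˡ (sum rep) (d ·ᴸ w) (φ u) (begin
    sum rep ⊕ (d ·ᴸ w)                                ≡⟨ ≡.cong (sum rep ⊕_) (≡.sym (sum-replicate {m} d {w})) ⟩
    sum rep ⊕ sum (replicate d w)                    ≡⟨ ≡.sym (∑-distrib-+ {m} rep (replicate d w)) ⟩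
    sum (λ i → rep i ⊕ w)                            ≡⟨ sum-cong-≋ {m} (λ i → proj₂ (∼-rep-class (rep i ⊕ w))) ⟩
    sum (λ i → rep (translate w i) ⊕ φ (uᵢ i))       ≡⟨ ∑-distrib-+ {m} (λ i → rep (translate w i)) (λ i → φ (uᵢ i)) ⟩
    sum (λ i → rep (translate w i)) ⊕ sum (λ i → φ (uᵢ i))
                                                     ≡⟨ ≡.cong₂ _⊕_ (≡.sym (sum-permute rep (translation w))) (≡.sym (φ-sum uᵢ)) ⟩
    sum rep ⊕ φ u                                    ∎))
    where
    uᵢ : Fin d → Lat n
    uᵢ i = proj₁ (∼-rep-class (rep i ⊕ w))
    u : Lat n
    u = sum uᵢ

module IdealPowers {c ℓ ℓi} (S : CommutativeRing c ℓ) (I : CommutativeRing.Carrier S → Set ℓi) where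
  open CommutativeRing S
  open import Algebra.Properties.Ring ring using (-‿distribˡ-*)
  open import Algebra.Properties.Semiring.Exp semiring public using (_^_)
  open import Algebra.Properties.Semiring.Mult semiring public using () renaming (_×_ to _·_)
  open import Relation.Binary.Reasoning.Setoid setoid
  open ℤ-Solver S using (solve; _:+_; _:*_; _:-_; :-_; _:=_; con)

  prod : ∀ {k} → Vec Carrier k → Carrier
  prod = Vec.foldr _ _*_ 1#

  Monomial : ℕ → Set c
  Monomial k = Carrier × Vec Carrier k

  ⟦_⟧ᵐ : ∀ {k} → Monomial k → Carrier
  ⟦ r , fs ⟧ᵐ = r * prod fs

  ⟦_⟧ᵖ : ∀ {k} → List (Monomial k) → Carrier
  ⟦ ts ⟧ᵖ = List.foldr _+_ 0# (List.map ⟦_⟧ᵐ ts)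

  InI^ : ∀ {k} → List (Monomial k) → Set (c ⊔ ℓi)
  InI^ = LAll.All (λ t → VAll.All I (proj₂ t))

  infix 4 _∈I^_
  _∈I^_ : Carrier → ℕ → Set (c ⊔ ℓ ⊔ ℓi)
  x ∈I^ k = Σ (List (Monomial k)) λ ts → InI^ ts × x ≈ ⟦ ts ⟧ᵖ

  ∈I^-resp-≈ : ∀ {k x y} → x ≈ y → x ∈I^ k → y ∈I^ k
  ∈I^-resp-≈ x≈y (ts , ts∈I , x≈ts) = ts , ts∈I , trans (sym x≈y) x≈ts

  0#∈I^ : ∀ {k} → 0# ∈I^ k
  0#∈I^ = [] , LAll.[] , refl

  monomial∈I^ : ∀ {k} r (fs : Vec Carrier k) → VAll.All I fs → r * prod fs ∈I^ k
  monomial∈I^ r fs fs∈I = (r , fs) ∷ [] , fs∈I LAll.∷ LAll.[] , sym (+-identityʳ _)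

  ⟦++⟧ᵖ : ∀ {k} (ts us : List (Monomial k)) → ⟦ ts ++ us ⟧ᵖ ≈ ⟦ ts ⟧ᵖ + ⟦ us ⟧ᵖ
  ⟦++⟧ᵖ [] us = sym (+-identityˡ _)
  ⟦++⟧ᵖ (t ∷ ts) us = trans (+-congˡ (⟦++⟧ᵖ ts us)) (sym (+-assoc _ _ _))

  +-closed : ∀ {k x y} → x ∈I^ k → y ∈I^ k → x + y ∈I^ k
  +-closed (ts , ts∈I , x≈ts) (us , us∈I , y≈us) =
    ts ++ us , LAll.++⁺ ts∈I us∈I , trans (+-cong x≈ts y≈us) (sym (⟦++⟧ᵖ ts us))

  ∈I^-elim : ∀ {p k} (P : Carrier → Set p) → (∀ {x y} → x ≈ y → P x → P y) →
             P 0# → (∀ {x y} → P x → P y → P (x + y)) →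
             (∀ r fs → VAll.All I fs → P (r * prod fs)) →
             ∀ {x} → x ∈I^ k → P x
  ∈I^-elim {k = k} P P-resp P-0# P-+ P-monomial (ts , ts∈I , x≈ts) = P-resp (sym x≈ts) (go ts ts∈I)
    where
    go : ∀ ts → InI^ ts → P ⟦ ts ⟧ᵖ
    go [] LAll.[] = P-0#
    go ((r , fs) ∷ ts) (fs∈I LAll.∷ ts∈I) = P-+ (P-monomial r fs fs∈I) (go ts ts∈I)

  *ˡ-closed : ∀ {k x} r → x ∈I^ k → r * x ∈I^ k
  *ˡ-closed {k} r = ∈I^-elim (λ x → r * x ∈I^ k) (λ x≈y → ∈I^-resp-≈ (*-congˡ x≈y))
    (∈I^-resp-≈ (sym (zeroʳ r)) 0#∈I^) (λ rx rz → ∈I^-resp-≈ (sym (distribˡ r _ _)) (+-closed rx rz))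
    (λ s fs fs∈I → ∈I^-resp-≈ (*-assoc r s _) (monomial∈I^ (r * s) fs fs∈I))

  *ʳ-closed : ∀ {k x} r → x ∈I^ k → x * r ∈I^ k
  *ʳ-closed r x∈I^k = ∈I^-resp-≈ (*-comm r _) (*ˡ-closed r x∈I^k)

  -‿closed : ∀ {k x} → x ∈I^ k → - x ∈I^ k
  -‿closed {x = x} x∈I^k =
    ∈I^-resp-≈ (trans (sym (-‿distribˡ-* 1# x)) (-‿cong (*-identityˡ x))) (*ˡ-closed (- 1#) x∈I^k)

  ∈I^0 : ∀ x → x ∈I^ 0
  ∈I^0 x = ∈I^-resp-≈ (*-identityʳ x) (monomial∈I^ x [] VAll.[])

  ∈I⇒∈I^1 : ∀ {f} → I f → f ∈I^ 1
  ∈I⇒∈I^1 {f} f∈I = ∈I^-resp-≈ (trans (*-identityˡ _) (*-identityʳ f)) (monomial∈I^ 1# (f ∷ []) (f∈I VAll.∷ VAll.[]))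

  ∈I^-suc⇒∈I^ : ∀ {k x} → x ∈I^ suc k → x ∈I^ k
  ∈I^-suc⇒∈I^ {k} = ∈I^-elim (_∈I^ k) ∈I^-resp-≈ 0#∈I^ +-closed
    λ { r (f ∷ fs) (f∈I VAll.∷ fs∈I) → ∈I^-resp-≈ (*-assoc r f _) (monomial∈I^ (r * f) fs fs∈I) }

  ∈I^-antitone : ∀ {j k x} → j ≤ k → x ∈I^ k → x ∈I^ j
  ∈I^-antitone j≤k = go (ℕ.≤⇒≤′ j≤k)
    where
    go : ∀ {j k x} → j ℕ.≤′ k → x ∈I^ k → x ∈I^ j
    go ℕ.≤′-refl = λ x∈I^j → x∈I^j
    go (ℕ.≤′-step j≤′k) = λ x∈I^k → go j≤′k (∈I^-suc⇒∈I^ x∈I^k)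

  prod-++ : ∀ {j k} (fs : Vec Carrier j) (gs : Vec Carrier k) → prod (fs Vec.++ gs) ≈ prod fs * prod gs
  prod-++ [] gs = sym (*-identityˡ _)
  prod-++ (f ∷ fs) gs = trans (*-congˡ (prod-++ fs gs)) (sym (*-assoc _ _ _))

  *-closed : ∀ {j k x y} → x ∈I^ j → y ∈I^ k → x * y ∈I^ (j ℕ.+ k)
  *-closed {j} {k} {y = y} x∈I^j y∈I^k =
    ∈I^-elim (λ x → x * y ∈I^ j ℕ.+ k) (λ x≈x′ → ∈I^-resp-≈ (*-congʳ x≈x′))
      (∈I^-resp-≈ (sym (zeroˡ y)) 0#∈I^) (λ p q → ∈I^-resp-≈ (sym (distribʳ y _ _)) (+-closed p q))
      (λ r fs fs∈I → *ˡ-closed-monomial r fs fs∈I) x∈I^j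
    where
    swap : ∀ r s a b → (r * s) * (a * b) ≈ (r * a) * (s * b)
    swap = solve 4 (λ r s a b → (r :* s) :* (a :* b) := (r :* a) :* (s :* b)) refl
    *ˡ-closed-monomial : ∀ r (fs : Vec Carrier j) → VAll.All I fs → (r * prod fs) * y ∈I^ j ℕ.+ k
    *ˡ-closed-monomial r fs fs∈I = ∈I^-resp-≈ (*-comm y _)
      (∈I^-elim (λ y → y * (r * prod fs) ∈I^ j ℕ.+ k) (λ y≈y′ → ∈I^-resp-≈ (*-congʳ y≈y′))
        (∈I^-resp-≈ (sym (zeroˡ _)) 0#∈I^) (λ p q → ∈I^-resp-≈ (sym (distribʳ _ _ _)) (+-closed p q))
        (λ s gs gs∈I → ∈I^-resp-≈ (trans (trans (*-congˡ (prod-++ fs gs)) (swap r s (prod fs) (prod gs))) (*-comm _ _))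
                                   (monomial∈I^ (r * s) (fs Vec.++ gs) (VAll.++⁺ fs∈I gs∈I)))
        y∈I^k)

  -- A record, so that k, x and y can be inferred from a proof.
  record _≈[_]_ (x : Carrier) (k : ℕ) (y : Carrier) : Set (c ⊔ ℓ ⊔ ℓi) where
    constructor ⟪_⟫
    field ≈[]⇒∈I^ : x - y ∈I^ k
  open _≈[_]_ public
  infix 4 _≈[_]_

  ≈[]-reflexive : ∀ {k x y} → x ≈ y → x ≈[ k ] y
  ≈[]-reflexive {x = x} x≈y = ⟪ ∈I^-resp-≈ (trans (sym (-‿inverseʳ x)) (+-congˡ (-‿cong x≈y))) 0#∈I^ ⟫

  ≈[]-refl : ∀ {k x} → x ≈[ k ] x
  ≈[]-refl = ≈[]-reflexive refl

  ≈[]-sym : ∀ {k x y} → x ≈[ k ] y → y ≈[ k ] x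
  ≈[]-sym {x = x} {y} ⟪ x-y ⟫ = ⟪ ∈I^-resp-≈ (lemma x y) (-‿closed x-y) ⟫
    where
    lemma : ∀ x y → - (x - y) ≈ y - x
    lemma = solve 2 (λ x y → :- (x :- y) := y :- x) refl

  ≈[]-trans : ∀ {k x y z} → x ≈[ k ] y → y ≈[ k ] z → x ≈[ k ] z
  ≈[]-trans {x = x} {y} {z} ⟪ x-y ⟫ ⟪ y-z ⟫ = ⟪ ∈I^-resp-≈ (lemma x y z) (+-closed x-y y-z) ⟫
    where
    lemma : ∀ x y z → (x - y) + (y - z) ≈ x - z
    lemma = solve 3 (λ x y z → (x :- y) :+ (y :- z) := x :- z) refl

  ≈[]-setoid : ℕ → Setoid c (c ⊔ ℓ ⊔ ℓi)
  ≈[]-setoid k = record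
    { Carrier = Carrier ; _≈_ = _≈[ k ]_
    ; isEquivalence = record { refl = ≈[]-refl ; sym = ≈[]-sym ; trans = ≈[]-trans } }

  ≈[]-+ : ∀ {k x y x′ y′} → x ≈[ k ] y → x′ ≈[ k ] y′ → x + x′ ≈[ k ] y + y′
  ≈[]-+ {x = x} {y} {x′} {y′} ⟪ x-y ⟫ ⟪ x′-y′ ⟫ = ⟪ ∈I^-resp-≈ (lemma x y x′ y′) (+-closed x-y x′-y′) ⟫
    where
    lemma : ∀ x y x′ y′ → (x - y) + (x′ - y′) ≈ (x + x′) - (y + y′)
    lemma = solve 4 (λ x y x′ y′ → (x :- y) :+ (x′ :- y′) := (x :+ x′) :- (y :+ y′)) refl

  ≈[]-* : ∀ {k x y x′ y′} → x ≈[ k ] y → x′ ≈[ k ] y′ → x * x′ ≈[ k ] y * y′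
  ≈[]-* {x = x} {y} {x′} {y′} ⟪ x-y ⟫ ⟪ x′-y′ ⟫ =
    ⟪ ∈I^-resp-≈ (lemma x y x′ y′) (+-closed (*ˡ-closed x x′-y′) (*ʳ-closed y′ x-y)) ⟫
    where
    lemma : ∀ x y x′ y′ → x * (x′ - y′) + (x - y) * y′ ≈ x * x′ - y * y′
    lemma = solve 4 (λ x y x′ y′ → x :* (x′ :- y′) :+ (x :- y) :* y′ := x :* x′ :- y :* y′) refl

  ≈[]-^ : ∀ {k x y} n → x ≈[ k ] y → x ^ n ≈[ k ] y ^ n
  ≈[]-^ zero x≈y = ≈[]-refl
  ≈[]-^ (suc n) x≈y = ≈[]-* x≈y (≈[]-^ n x≈y)

  ≈[]-antitone : ∀ {j k x y} → j ≤ k → x ≈[ k ] y → x ≈[ j ] y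
  ≈[]-antitone j≤k ⟪ x-y ⟫ = ⟪ ∈I^-antitone j≤k x-y ⟫

  ≈[]-∈I^ : ∀ {j k x y} → x ≈[ k ] y → j ≤ k → y ∈I^ j → x ∈I^ j
  ≈[]-∈I^ {x = x} {y} ⟪ x-y ⟫ j≤k y∈I^j = ∈I^-resp-≈ (lemma x y) (+-closed (∈I^-antitone j≤k x-y) y∈I^j)
    where
    lemma : ∀ x y → (x - y) + y ≈ x
    lemma = solve 2 (λ x y → (x :- y) :+ y := x) refl

  1#^n≈1# : ∀ n → 1# ^ n ≈ 1#
  1#^n≈1# zero = refl
  1#^n≈1# (suc n) = trans (*-identityˡ _) (1#^n≈1# n)

  geometric : Carrier → Carrier → ℕ → Carrier
  geometric x y zero = 0#
  geometric x y (suc n) = x ^ n + y * geometric x y n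

  geometric-telescopes : ∀ x y n → (x - y) * geometric x y n ≈ x ^ n - y ^ n
  geometric-telescopes x y zero = trans (zeroʳ _) (sym (-‿inverseʳ 1#))
  geometric-telescopes x y (suc n) = begin
    (x - y) * (x ^ n + y * g)                 ≈⟨ distribute x y (x ^ n) g ⟩
    (x - y) * x ^ n + y * ((x - y) * g)       ≈⟨ +-congˡ (*-congˡ (geometric-telescopes x y n)) ⟩
    (x - y) * x ^ n + y * (x ^ n - y ^ n)     ≈⟨ collect x y (x ^ n) (y ^ n) ⟩
    x * x ^ n - y * y ^ n                     ∎
    where
    g : Carrier
    g = geometric x y n
    distribute : ∀ x y a g → (x - y) * (a + y * g) ≈ (x - y) * a + y * ((x - y) * g)
    distribute = solve 4 (λ x y a g → (x :- y) :* (a :+ y :* g) := (x :- y) :* a :+ y :* ((x :- y) :* g)) refl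
    collect : ∀ x y a b → (x - y) * a + y * (a - b) ≈ x * a - y * b
    collect = solve 4 (λ x y a b → (x :- y) :* a :+ y :* (a :- b) := x :* a :- y :* b) refl

  geometric-cong : ∀ {k x y x′ y′} n → x ≈[ k ] x′ → y ≈[ k ] y′ → geometric x y n ≈[ k ] geometric x′ y′ n
  geometric-cong zero x≈x′ y≈y′ = ≈[]-refl
  geometric-cong (suc n) x≈x′ y≈y′ = ≈[]-+ (≈[]-^ n x≈x′) (≈[]-* y≈y′ (geometric-cong n x≈x′ y≈y′))

  geometric-1#-1# : ∀ n → geometric 1# 1# n ≈ n · 1#
  geometric-1#-1# zero = refl
  geometric-1#-1# (suc n) = +-cong (1#^n≈1# n) (trans (*-identityˡ _) (geometric-1#-1# n))

  geometric-≈[1] : ∀ {u v} n → u ≈[ 1 ] 1# → v ≈[ 1 ] 1# → geometric u v n ≈[ 1 ] n · 1#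
  geometric-≈[1] n u≈1 v≈1 = ≈[]-trans (geometric-cong n u≈1 v≈1) (≈[]-reflexive (geometric-1#-1# n))

  -- (r - x)ⁿ ≡ rⁿ - n rⁿ⁻¹ x  modulo x², where n rⁿ⁻¹ = geometric r r n.
  ^-first-order : ∀ r x n → Σ Carrier λ c → (r - x) ^ n ≈ r ^ n - x * geometric r r n + x * x * c
  ^-first-order r x zero = 0# , lemma r x
    where
    lemma : ∀ r x → 1# ≈ 1# - x * 0# + x * x * 0#
    lemma = solve 2 (λ r x → con (+ 1) := con (+ 1) :- x :* con (+ 0) :+ x :* x :* con (+ 0)) refl
  ^-first-order r x (suc n) with ^-first-order r x n
  ... | c , eq = r * c + geometric r r n - x * c , (begin
    (r - x) * (r - x) ^ n                                    ≈⟨ *-congˡ eq ⟩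
    (r - x) * (r ^ n - x * geometric r r n + x * x * c)      ≈⟨ lemma r x (r ^ n) (geometric r r n) c ⟩
    r * r ^ n - x * (r ^ n + r * geometric r r n) + x * x * (r * c + geometric r r n - x * c) ∎)
    where
    lemma : ∀ r x a g c → (r - x) * (a - x * g + x * x * c) ≈ r * a - x * (a + r * g) + x * x * (r * c + g - x * c)
    lemma = solve 5 (λ r x a g c → (r :- x) :* (a :- x :* g :+ x :* x :* c)
                                 := r :* a :- x :* (a :+ r :* g) :+ x :* x :* (r :* c :+ g :- x :* c)) refl

  module DthRoots (e : Carrier) (d : ℕ) (e*d≈1 : e * (d · 1#) ≈ 1#) where

    1-e*d≈0 : 1# - e * (d · 1#) ≈ 0#
    1-e*d≈0 = trans (+-congˡ (-‿cong e*d≈1)) (-‿inverseʳ 1#)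

    *[1-e*d]∈I^ : ∀ {k} x → x * (1# - e * (d · 1#)) ∈I^ k
    *[1-e*d]∈I^ x = ∈I^-resp-≈ (sym (trans (*-congˡ 1-e*d≈0) (zeroʳ x))) 0#∈I^

    -- u - v = e (uᵈ - vᵈ) - e (u - v)(g - d) + (u - v)(1 - e d)  with  g = geometric u v d ∈ d + I,
    -- so u - v ∈ Iʲ forces u - v ∈ Iʲ⁺¹ as long as uᵈ - vᵈ ∈ Iʲ⁺¹.
    ^d-injective-step : ∀ {u v j k} → u ≈[ 1 ] 1# → v ≈[ 1 ] 1# → suc j ≤ k →
                        u ^ d ≈[ k ] v ^ d → u ≈[ j ] v → u ≈[ suc j ] v
    ^d-injective-step {u} {v} {j} u≈1 v≈1 j<k ⟪ u^d-v^d ⟫ ⟪ u-v ⟫ =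
      ⟪ ∈I^-resp-≈ (sym (decomposition u v e g (d · 1#))) (+-closed (+-closed main error) (*[1-e*d]∈I^ (u - v))) ⟫
      where
      g : Carrier
      g = geometric u v d
      main : e * ((u - v) * g) ∈I^ suc j
      main = *ˡ-closed e (∈I^-antitone j<k (∈I^-resp-≈ (sym (geometric-telescopes u v d)) u^d-v^d))
      error : - (e * ((u - v) * (g - d · 1#))) ∈I^ suc j
      error = -‿closed (*ˡ-closed e (∈I^-resp-≈ (*-comm _ _) (*-closed (≈[]⇒∈I^ (geometric-≈[1] d u≈1 v≈1)) u-v)))
      decomposition : ∀ u v e g m → u - v ≈ e * ((u - v) * g) - e * ((u - v) * (g - m)) + (u - v) * (1# - e * m)
      decomposition = solve 5 (λ u v e g m → u :- v := e :* ((u :- v) :* g) :- e :* ((u :- v) :* (g :- m))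
                                                      :+ (u :- v) :* (con (+ 1) :- e :* m)) refl

    ^d-injective : ∀ {u v k} → u ≈[ 1 ] 1# → v ≈[ 1 ] 1# → u ^ d ≈[ k ] v ^ d → u ≈[ k ] v
    ^d-injective {u} {v} {k} u≈1 v≈1 u^d≈v^d = go k ℕ.≤-refl
      where
      go : ∀ j → j ≤ k → u ≈[ j ] v
      go zero _ = ⟪ ∈I^0 _ ⟫
      go (suc j) j<k = ^d-injective-step u≈1 v≈1 j<k u^d≈v^d (go j (ℕ.≤-trans (ℕ.n≤1+n j) j<k))

    -- Newton's step r ↦ r - x with x = e (rᵈ - t):  (r - x)ᵈ - t = (rᵈ - t)(1 - e d) + x (d - g) + x² c
    -- with g = geometric r r d ∈ d + I, so the error moves from Iᵏ⁺¹ into Iᵏ⁺².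
    newton-step : ∀ {t r k} → r ≈[ 1 ] 1# → r ^ d ≈[ suc k ] t →
                  r - e * (r ^ d - t) ≈[ 1 ] 1# × (r - e * (r ^ d - t)) ^ d ≈[ suc (suc k) ] t
    newton-step {t} {r} {k} r≈1 ⟪ r^d-t ⟫ with ^-first-order r (e * (r ^ d - t)) d
    ... | c , expansion = r-x≈1 ,
      ⟪ ∈I^-resp-≈ (sym (trans (+-congʳ expansion) (decomposition (r ^ d) t e g (d · 1#) c)))
          (+-closed (+-closed (*[1-e*d]∈I^ (r ^ d - t)) linear-term) quadratic-term) ⟫
      where
      x g : Carrier
      x = e * (r ^ d - t)
      g = geometric r r d
      x∈I^ : x ∈I^ suc k
      x∈I^ = *ˡ-closed e r^d-t
      r-x≈1 : r - x ≈[ 1 ] 1#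
      r-x≈1 = ⟪ ∈I^-resp-≈ (swap r x) (+-closed (≈[]⇒∈I^ r≈1) (-‿closed (∈I^-antitone (s≤s z≤n) x∈I^))) ⟫
        where
        swap : ∀ r x → (r - 1#) - x ≈ (r - x) - 1#
        swap = solve 2 (λ r x → (r :- con (+ 1)) :- x := (r :- x) :- con (+ 1)) refl
      linear-term : x * (d · 1# - g) ∈I^ suc (suc k)
      linear-term = ∈I^-antitone (ℕ.≤-reflexive (ℕ.+-comm 1 (suc k)))
        (*-closed x∈I^ (∈I^-resp-≈ (neg-sub g (d · 1#)) (-‿closed (≈[]⇒∈I^ (geometric-≈[1] d r≈1 r≈1)))))
        where
        neg-sub : ∀ g m → - (g - m) ≈ m - g
        neg-sub = solve 2 (λ g m → :- (g :- m) := m :- g) refl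
      quadratic-term : x * x * c ∈I^ suc (suc k)
      quadratic-term = *ʳ-closed c (∈I^-antitone (s≤s (ℕ.m≤n+m (suc k) k)) (*-closed x∈I^ x∈I^))
      decomposition : ∀ a t e g m c → (a - (e * (a - t)) * g + (e * (a - t)) * (e * (a - t)) * c) - t ≈
                        (a - t) * (1# - e * m) + (e * (a - t)) * (m - g) + (e * (a - t)) * (e * (a - t)) * c
      decomposition = solve 6 (λ a t e g m c →
        (a :- (e :* (a :- t)) :* g :+ (e :* (a :- t)) :* (e :* (a :- t)) :* c) :- t :=
        (a :- t) :* (con (+ 1) :- e :* m) :+ (e :* (a :- t)) :* (m :- g) :+ (e :* (a :- t)) :* (e :* (a :- t)) :* c) refl

    ^d-surjective : ∀ {t} → t ≈[ 1 ] 1# → ∀ k → Σ Carrier λ r → r ≈[ 1 ] 1# × r ^ d ≈[ suc k ] t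
    ^d-surjective t≈1 zero = 1# , ≈[]-refl , ≈[]-trans (≈[]-reflexive (1#^n≈1# d)) (≈[]-sym t≈1)
    ^d-surjective {t} t≈1 (suc k) with ^d-surjective t≈1 k
    ... | r , r≈1 , r^d≈t = r - e * (r ^ d - t) , newton-step r≈1 r^d≈t

module GroupRingAlgebra {c ℓ} (A : CommutativeRing c ℓ) where
  open GroupRing A
  open CommutativeRing A renaming (Carrier to K)
  open import Algebra.Properties.Ring ring using (-‿+-comm; -0#≈0#)
  open import Relation.Binary.Reasoning.Setoid setoid
  open ℤ-Solver A using (solve; _:+_; _:=_)

  -- A record, so that both sides can be inferred from a proof.
  record _≃_ {n : ℕ} (p q : A[ n ]) : Set ℓ where
    constructor ⟪_⟫
    field coeff-≈ : p ≋ q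
  open _≃_ public
  infix 4 _≃_

  module _ {n : ℕ} where

    ≃-refl : ∀ {p : A[ n ]} → p ≃ p
    ≃-refl = ⟪ (λ l → refl) ⟫

    ≃-sym : ∀ {p q : A[ n ]} → p ≃ q → q ≃ p
    ≃-sym ⟪ p≋q ⟫ = ⟪ (λ l → sym (p≋q l)) ⟫

    ≃-trans : ∀ {p q r : A[ n ]} → p ≃ q → q ≃ r → p ≃ r
    ≃-trans ⟪ p≋q ⟫ ⟪ q≋r ⟫ = ⟪ (λ l → trans (p≋q l) (q≋r l)) ⟫

    ≃-reflexive : ∀ {p q : A[ n ]} → p ≡ q → p ≃ q
    ≃-reflexive ≡.refl = ≃-refl

    coeff-++ : ∀ (p q : A[ n ]) l → coeff (p ++ q) l ≈ coeff p l + coeff q l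
    coeff-++ [] q l = sym (+-identityˡ _)
    coeff-++ ((a , l′) ∷ p) q l with does (≡-dec ℤ._≟_ l′ l)
    ... | true = trans (+-congˡ (coeff-++ p q l)) (sym (+-assoc _ _ _))
    ... | false = coeff-++ p q l

    coeff--ᴳ : ∀ (p : A[ n ]) l → coeff (-ᴳ p) l ≈ - coeff p l
    coeff--ᴳ [] l = sym -0#≈0#
    coeff--ᴳ ((a , l′) ∷ p) l with does (≡-dec ℤ._≟_ l′ l)
    ... | true = trans (+-congˡ (coeff--ᴳ p l)) (-‿+-comm a _)
    ... | false = coeff--ᴳ p l

    ++-cong : ∀ {p p′ q q′ : A[ n ]} → p ≃ p′ → q ≃ q′ → p ++ q ≃ p′ ++ q′
    ++-cong {p} {p′} {q} {q′} ⟪ p≋p′ ⟫ ⟪ q≋q′ ⟫ = ⟪ (λ l →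
      trans (coeff-++ p q l) (trans (+-cong (p≋p′ l) (q≋q′ l)) (sym (coeff-++ p′ q′ l)))) ⟫

    ++-comm : ∀ (p q : A[ n ]) → p ++ q ≃ q ++ p
    ++-comm p q = ⟪ (λ l → trans (coeff-++ p q l) (trans (+-comm _ _) (sym (coeff-++ q p l)))) ⟫

    ++-interchange : ∀ (p q r s : A[ n ]) → (p ++ q) ++ (r ++ s) ≃ (p ++ r) ++ (q ++ s)
    ++-interchange p q r s = ⟪ (λ l → begin
      coeff ((p ++ q) ++ (r ++ s)) l                   ≈⟨ expand p q r s l ⟩
      (coeff p l + coeff q l) + (coeff r l + coeff s l) ≈⟨ swap (coeff p l) (coeff q l) (coeff r l) (coeff s l) ⟩
      (coeff p l + coeff r l) + (coeff q l + coeff s l) ≈⟨ sym (expand p r q s l) ⟩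
      coeff ((p ++ r) ++ (q ++ s)) l                   ∎) ⟫
      where
      expand : ∀ p q r s l → coeff ((p ++ q) ++ (r ++ s)) l ≈ (coeff p l + coeff q l) + (coeff r l + coeff s l)
      expand p q r s l = trans (coeff-++ (p ++ q) (r ++ s) l) (+-cong (coeff-++ p q l) (coeff-++ r s l))
      swap : ∀ a b c d → (a + b) + (c + d) ≈ (a + c) + (b + d)
      swap = solve 4 (λ a b c d → (a :+ b) :+ (c :+ d) := (a :+ c) :+ (b :+ d)) refl

    -ᴳ-cong : ∀ {p q : A[ n ]} → p ≃ q → -ᴳ p ≃ -ᴳ q
    -ᴳ-cong {p} {q} ⟪ p≋q ⟫ = ⟪ (λ l → trans (coeff--ᴳ p l) (trans (-‿cong (p≋q l)) (sym (coeff--ᴳ q l)))) ⟫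

    -ᴳ-inverseˡ : ∀ (p : A[ n ]) → (-ᴳ p) ++ p ≃ []
    -ᴳ-inverseˡ p = ⟪ (λ l → trans (coeff-++ (-ᴳ p) p l) (trans (+-congʳ (coeff--ᴳ p l)) (-‿inverseˡ _))) ⟫

    -ᴳ-inverseʳ : ∀ (p : A[ n ]) → p ++ (-ᴳ p) ≃ []
    -ᴳ-inverseʳ p = ⟪ (λ l → trans (coeff-++ p (-ᴳ p) l) (trans (+-congˡ (coeff--ᴳ p l)) (-‿inverseʳ _))) ⟫

    ∷-cong : ∀ {a b : K} {l : Lat n} {p q : A[ n ]} → a ≈ b → p ≃ q → (a , l) ∷ p ≃ (b , l) ∷ q
    ∷-cong {a} {b} {l} {p} {q} a≈b ⟪ p≋q ⟫ = ⟪ go ⟫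
      where
      go : ∀ w → coeff ((a , l) ∷ p) w ≈ coeff ((b , l) ∷ q) w
      go w with does (≡-dec ℤ._≟_ l w)
      ... | true = +-cong a≈b (p≋q w)
      ... | false = p≋q w

    map-cong : ∀ (f g : K × Lat n → K × Lat n) (p : A[ n ]) →
      (∀ t → proj₁ (f t) ≈ proj₁ (g t)) → (∀ t → proj₂ (f t) ≡ proj₂ (g t)) → List.map f p ≃ List.map g p
    map-cong f g [] f₁≈g₁ f₂≡g₂ = ≃-refl
    map-cong f g (t ∷ p) f₁≈g₁ f₂≡g₂ with f t | g t | f₁≈g₁ t | f₂≡g₂ t
    ... | a , l | b , .l | a≈b | ≡.refl = ∷-cong a≈b (map-cong f g p f₁≈g₁ f₂≡g₂)

    _·ᵗ_ : K × Lat n → K × Lat n → K × Lat n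
    (a , l) ·ᵗ (b , l′) = (a * b , l ⊕ l′)

    *ᴳ-zeroʳ : ∀ (p : A[ n ]) → p *ᴳ [] ≡ []
    *ᴳ-zeroʳ [] = ≡.refl
    *ᴳ-zeroʳ (t ∷ p) = *ᴳ-zeroʳ p

    *ᴳ-distribʳ : ∀ (p p′ q : A[ n ]) → (p ++ p′) *ᴳ q ≡ (p *ᴳ q) ++ (p′ *ᴳ q)
    *ᴳ-distribʳ [] p′ q = ≡.refl
    *ᴳ-distribʳ (t ∷ p) p′ q = ≡.trans (≡.cong (List.map (t ·ᵗ_) q ++_) (*ᴳ-distribʳ p p′ q))
      (≡.sym (List.++-assoc (List.map (t ·ᵗ_) q) (p *ᴳ q) (p′ *ᴳ q)))

    *ᴳ-distribˡ : ∀ (p q q′ : A[ n ]) → p *ᴳ (q ++ q′) ≃ (p *ᴳ q) ++ (p *ᴳ q′)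
    *ᴳ-distribˡ [] q q′ = ≃-refl
    *ᴳ-distribˡ (t ∷ p) q q′ = ≃-trans
      (++-cong (≃-reflexive (List.map-++ (t ·ᵗ_) q q′)) (*ᴳ-distribˡ p q q′))
      (++-interchange (List.map (t ·ᵗ_) q) (List.map (t ·ᵗ_) q′) (p *ᴳ q) (p *ᴳ q′))

    -- Right multiplication by one term; its coefficient formula coeff-scale makes *ᴳ respect ≃.
    scale : K × Lat n → A[ n ] → A[ n ]
    scale (b , c) = List.map (_·ᵗ (b , c))

    *ᴳ-∷ʳ : ∀ (p : A[ n ]) t q → p *ᴳ (t ∷ q) ≃ scale t p ++ (p *ᴳ q)
    *ᴳ-∷ʳ [] t q = ≃-refl
    *ᴳ-∷ʳ (s ∷ p) t q = ∷-cong refl (≃-trans (++-cong ≃-refl (*ᴳ-∷ʳ p t q))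
      (≃-trans (≃-sym (≃-reflexive (List.++-assoc (List.map (s ·ᵗ_) q) (scale t p) (p *ᴳ q))))
        (≃-trans (++-cong (++-comm (List.map (s ·ᵗ_) q) (scale t p)) ≃-refl)
          (≃-reflexive (List.++-assoc (scale t p) (List.map (s ·ᵗ_) q) (p *ᴳ q))))))

    coeff-scale : ∀ b c (p : A[ n ]) w → coeff (scale (b , c) p) w ≈ coeff p (w ⊕ (-ᴸ c)) * b
    coeff-scale b c [] w = sym (zeroˡ b)
    coeff-scale b c ((a , l) ∷ p) w with ≡-dec ℤ._≟_ (l ⊕ c) w | ≡-dec ℤ._≟_ l (w ⊕ (-ᴸ c))
    ... | yes _ | yes _ = trans (+-congˡ (coeff-scale b c p w)) (sym (distribʳ b a _))
    ... | no _ | no _ = coeff-scale b c p w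
    ... | yes l⊕c≡w | no l≢w-c = ⊥-elim (l≢w-c (a⊕c≡w⇒a≡w⊕-c l⊕c≡w))
    ... | no l⊕c≢w | yes l≡w-c = ⊥-elim (l⊕c≢w (a≡w⊕-c⇒a⊕c≡w l≡w-c))

    scale-cong : ∀ t {p p′ : A[ n ]} → p ≃ p′ → scale t p ≃ scale t p′
    scale-cong (b , c) {p} {p′} ⟪ p≋p′ ⟫ = ⟪ (λ w →
      trans (coeff-scale b c p w) (trans (*-congʳ (p≋p′ _)) (sym (coeff-scale b c p′ w)))) ⟫

    *ᴳ-congʳ : ∀ {p p′ : A[ n ]} q → p ≃ p′ → p *ᴳ q ≃ p′ *ᴳ q
    *ᴳ-congʳ {p} {p′} [] p≃p′ = ≃-reflexive (≡.trans (*ᴳ-zeroʳ p) (≡.sym (*ᴳ-zeroʳ p′)))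
    *ᴳ-congʳ {p} {p′} (t ∷ q) p≃p′ = ≃-trans (*ᴳ-∷ʳ p t q)
      (≃-trans (++-cong (scale-cong t p≃p′) (*ᴳ-congʳ q p≃p′)) (≃-sym (*ᴳ-∷ʳ p′ t q)))

    *ᴳ-comm : ∀ (p q : A[ n ]) → p *ᴳ q ≃ q *ᴳ p
    *ᴳ-comm [] q = ≃-reflexive (≡.sym (*ᴳ-zeroʳ q))
    *ᴳ-comm (t ∷ p) q = ≃-trans
      (++-cong (map-cong (t ·ᵗ_) (_·ᵗ t) q (λ s → *-comm (proj₁ t) (proj₁ s)) (λ s → ⊕-comm (proj₂ t) (proj₂ s)))
               (*ᴳ-comm p q))
      (≃-sym (*ᴳ-∷ʳ q t p))

    *ᴳ-cong : ∀ {p p′ q q′ : A[ n ]} → p ≃ p′ → q ≃ q′ → p *ᴳ q ≃ p′ *ᴳ q′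
    *ᴳ-cong {p} {p′} {q} {q′} p≃p′ q≃q′ = ≃-trans (*ᴳ-congʳ q p≃p′)
      (≃-trans (*ᴳ-comm p′ q) (≃-trans (*ᴳ-congʳ p′ q≃q′) (*ᴳ-comm q′ p′)))

    map-·ᵗ-*ᴳ : ∀ t (q r : A[ n ]) → List.map (t ·ᵗ_) q *ᴳ r ≃ List.map (t ·ᵗ_) (q *ᴳ r)
    map-·ᵗ-*ᴳ t [] r = ≃-refl
    map-·ᵗ-*ᴳ (a , l) ((b , l′) ∷ q) r = ≃-trans
      (++-cong (≃-trans (map-cong _ _ r (λ s → *-assoc a b (proj₁ s)) (λ s → ⊕-assoc l l′ (proj₂ s)))
                        (≃-reflexive (List.map-∘ r)))
               (map-·ᵗ-*ᴳ (a , l) q r))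
      (≃-reflexive (≡.sym (List.map-++ ((a , l) ·ᵗ_) (List.map ((b , l′) ·ᵗ_) r) (q *ᴳ r))))

    *ᴳ-assoc : ∀ (p q r : A[ n ]) → (p *ᴳ q) *ᴳ r ≃ p *ᴳ (q *ᴳ r)
    *ᴳ-assoc [] q r = ≃-refl
    *ᴳ-assoc (t ∷ p) q r = ≃-trans (≃-reflexive (*ᴳ-distribʳ (List.map (t ·ᵗ_) q) (p *ᴳ q) r))
      (++-cong (map-·ᵗ-*ᴳ t q r) (*ᴳ-assoc p q r))

    *ᴳ-identityˡ : ∀ (p : A[ n ]) → oneᴳ *ᴳ p ≃ p
    *ᴳ-identityˡ p = ≃-trans (≃-reflexive (List.++-identityʳ _))
      (≃-trans (map-cong _ (λ t → t) p (λ t → *-identityˡ (proj₁ t)) (λ t → ⊕-identityˡ (proj₂ t)))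
               (≃-reflexive (List.map-id p)))

  A[_]-commutativeRing : ℕ → CommutativeRing c ℓ
  A[ n ]-commutativeRing = record
    { Carrier = A[ n ] ; _≈_ = _≃_ ; _+_ = _++_ ; _*_ = _*ᴳ_ ; -_ = -ᴳ_ ; 0# = [] ; 1# = oneᴳ
    ; isCommutativeRing = record
      { isRing = record
        { +-isAbelianGroup = record
          { isGroup = record
            { isMonoid = record
              { isSemigroup = record
                { isMagma = record
                  { isEquivalence = record { refl = ≃-refl ; sym = ≃-sym ; trans = ≃-trans }
                  ; ∙-cong = ++-cong }
                ; assoc = λ p q r → ≃-reflexive (List.++-assoc p q r) }
              ; identity = (λ _ → ≃-refl) , (λ p → ≃-reflexive (List.++-identityʳ p)) }
            ; inverse = -ᴳ-inverseˡ , -ᴳ-inverseʳ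
            ; ⁻¹-cong = -ᴳ-cong }
          ; comm = ++-comm }
        ; *-cong = *ᴳ-cong
        ; *-assoc = *ᴳ-assoc
        ; *-identity = *ᴳ-identityˡ , (λ p → ≃-trans (*ᴳ-comm p oneᴳ) (*ᴳ-identityˡ p))
        ; distrib = *ᴳ-distribˡ , (λ p q q′ → ≃-reflexive (*ᴳ-distribʳ q q′ p)) }
      ; *-comm = *ᴳ-comm } }

module LinearExtension {c ℓ c′ ℓ′} (A : CommutativeRing c ℓ) (S : CommutativeRing c′ ℓ′)
  (emb : CommutativeRing.Carrier A → CommutativeRing.Carrier S)
  (emb-cong : ∀ {a b} → CommutativeRing._≈_ A a b → CommutativeRing._≈_ S (emb a) (emb b))
  (emb-+ : ∀ a b → CommutativeRing._≈_ S (emb (CommutativeRing._+_ A a b)) (CommutativeRing._+_ S (emb a) (emb b)))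
  {n : ℕ} (g : Lat n → CommutativeRing.Carrier S) where
  open CommutativeRing S
  open GroupRing A
  open GroupRingAlgebra A using (_≃_; ⟪_⟫; coeff-++; coeff--ᴳ)
  private module A = CommutativeRing A
  open import Algebra.Properties.Ring ring using (-0#≈0#; -‿distribˡ-*; -‿+-comm; x+x≈x⇒x≈0)
  open import Algebra.Properties.Group +-group using (inverseˡ-unique)
  open import Relation.Binary.Reasoning.Setoid setoid
  open ℤ-Solver S using (solve; _:+_; _:=_)

  linear : A[ n ] → Carrier
  linear [] = 0#
  linear ((a , l) ∷ p) = emb a * g l + linear p

  emb-0# : emb A.0# ≈ 0#
  emb-0# = x+x≈x⇒x≈0 (emb A.0#) (trans (sym (emb-+ A.0# A.0#)) (emb-cong (A.+-identityˡ A.0#)))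

  emb-neg : ∀ a → emb (A.- a) ≈ - emb a
  emb-neg a = inverseˡ-unique (emb (A.- a)) (emb a)
    (trans (sym (emb-+ (A.- a) a)) (trans (emb-cong (A.-‿inverseˡ a)) emb-0#))

  linear-++ : ∀ (p q : A[ n ]) → linear (p ++ q) ≈ linear p + linear q
  linear-++ [] q = sym (+-identityˡ _)
  linear-++ ((a , l) ∷ p) q = trans (+-congˡ (linear-++ p q)) (sym (+-assoc _ _ _))

  linear--ᴳ : ∀ (p : A[ n ]) → linear (-ᴳ p) ≈ - linear p
  linear--ᴳ [] = sym -0#≈0#
  linear--ᴳ ((a , l) ∷ p) =
    trans (+-cong (trans (*-congʳ (emb-neg a)) (sym (-‿distribˡ-* _ _))) (linear--ᴳ p)) (-‿+-comm _ _)

  at other : Lat n → A[ n ] → A[ n ]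
  at l [] = []
  at l ((a , l′) ∷ p) = if does (≡-dec ℤ._≟_ l′ l) then (a , l′) ∷ at l p else at l p
  other l [] = []
  other l ((a , l′) ∷ p) = if does (≡-dec ℤ._≟_ l′ l) then other l p else (a , l′) ∷ other l p

  linear-split : ∀ l (p : A[ n ]) → linear p ≈ linear (at l p) + linear (other l p)
  linear-split l [] = sym (+-identityʳ _)
  linear-split l ((a , l′) ∷ p) with does (≡-dec ℤ._≟_ l′ l)
  ... | true = trans (+-congˡ (linear-split l p)) (sym (+-assoc _ _ _))
  ... | false = trans (+-congˡ (linear-split l p)) (swap _ _ _)
    where
    swap : ∀ x y z → x + (y + z) ≈ y + (x + z)
    swap = solve 3 (λ x y z → x :+ (y :+ z) := y :+ (x :+ z)) refl

  linear-at : ∀ l (p : A[ n ]) → linear (at l p) ≈ emb (coeff p l) * g l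
  linear-at l [] = sym (trans (*-congʳ emb-0#) (zeroˡ _))
  linear-at l ((a , l′) ∷ p) with ≡-dec ℤ._≟_ l′ l
  ... | yes ≡.refl = trans (+-congˡ (linear-at l p)) (trans (sym (distribʳ _ _ _)) (*-congʳ (sym (emb-+ a _))))
  ... | no _ = linear-at l p

  coeff-other-at : ∀ l (p : A[ n ]) → coeff (other l p) l A.≈ A.0#
  coeff-other-at l [] = A.refl
  coeff-other-at l ((a , l′) ∷ p) with ≡-dec ℤ._≟_ l′ l
  ... | yes _ = coeff-other-at l p
  ... | no l′≢l with ≡-dec ℤ._≟_ l′ l
  ...   | yes l′≡l = ⊥-elim (l′≢l l′≡l)
  ...   | no _ = coeff-other-at l p

  coeff-other-≢ : ∀ l w (p : A[ n ]) → ¬ (w ≡ l) → coeff (other l p) w A.≈ coeff p w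
  coeff-other-≢ l w [] w≢l = A.refl
  coeff-other-≢ l w ((a , l′) ∷ p) w≢l with ≡-dec ℤ._≟_ l′ l
  ... | yes ≡.refl with ≡-dec ℤ._≟_ l′ w
  ...   | yes ≡.refl = ⊥-elim (w≢l ≡.refl)
  ...   | no _ = coeff-other-≢ l w p w≢l
  coeff-other-≢ l w ((a , l′) ∷ p) w≢l | no _ with ≡-dec ℤ._≟_ l′ w
  ...   | yes _ = A.+-congˡ (coeff-other-≢ l w p w≢l)
  ...   | no _ = coeff-other-≢ l w p w≢l

  length-other : ∀ l (p : A[ n ]) → List.length (other l p) ≤ List.length p
  length-other l [] = z≤n
  length-other l ((a , l′) ∷ p) with does (≡-dec ℤ._≟_ l′ l)
  ... | true = ℕ.m≤n⇒m≤1+n (length-other l p)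
  ... | false = s≤s (length-other l p)

  length-other-head : ∀ a l (p : A[ n ]) → List.length (other l ((a , l) ∷ p)) ≤ List.length p
  length-other-head a l p with ≡-dec ℤ._≟_ l l
  ... | yes _ = length-other l p
  ... | no l≢l = ⊥-elim (l≢l ≡.refl)

  -- Induction on the length: the terms at the first point sum to a zero coefficient,
  -- and removing them leaves a shorter list that is still ≃ [].
  linear-≃[] : ∀ (p : A[ n ]) → p ≃ [] → linear p ≈ 0#
  linear-≃[] p = go p (List.length p) ℕ.≤-refl
    where
    go : ∀ p fuel → List.length p ≤ fuel → p ≃ [] → linear p ≈ 0#
    go [] _ _ _ = refl
    go ((a , l) ∷ p) (suc fuel) (s≤s len≤fuel) ⟪ q≋[] ⟫ = begin
      linear q                                   ≈⟨ linear-split l q ⟩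
      linear (at l q) + linear (other l q)       ≈⟨ +-cong (linear-at l q) other-vanishes ⟩
      emb (coeff q l) * g l + 0#                 ≈⟨ +-congʳ (trans (*-congʳ (trans (emb-cong (q≋[] l)) emb-0#)) (zeroˡ _)) ⟩
      0# + 0#                                    ≈⟨ +-identityˡ _ ⟩
      0#                                         ∎
      where
      q : A[ n ]
      q = (a , l) ∷ p
      other≋[] : ∀ w → coeff (other l q) w A.≈ A.0#
      other≋[] w with ≡-dec ℤ._≟_ w l
      ... | yes ≡.refl = coeff-other-at l q
      ... | no w≢l = A.trans (coeff-other-≢ l w q w≢l) (q≋[] w)
      other-vanishes : linear (other l q) ≈ 0#
      other-vanishes = go (other l q) fuel (ℕ.≤-trans (length-other-head a l p) len≤fuel) ⟪ other≋[] ⟫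

  linear-cong : ∀ {p q : A[ n ]} → p ≃ q → linear p ≈ linear q
  linear-cong {p} {q} ⟪ p≋q ⟫ = begin
    linear p                             ≈⟨ sym (+-identityʳ _) ⟩
    linear p + 0#                        ≈⟨ +-congˡ (sym (-‿inverseˡ (linear q))) ⟩
    linear p + (- linear q + linear q)   ≈⟨ sym (+-assoc _ _ _) ⟩
    (linear p - linear q) + linear q     ≈⟨ +-congʳ (trans (+-congˡ (sym (linear--ᴳ q))) (sym (linear-++ p (-ᴳ q)))) ⟩
    linear (p ++ (-ᴳ q)) + linear q      ≈⟨ +-congʳ (linear-≃[] (p ++ (-ᴳ q)) ⟪ p-q≋[] ⟫) ⟩
    0# + linear q                        ≈⟨ +-identityˡ _ ⟩
    linear q                             ∎
    where
    p-q≋[] : ∀ l → coeff (p ++ (-ᴳ q)) l A.≈ A.0#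
    p-q≋[] l = A.trans (coeff-++ p (-ᴳ q) l) (A.trans (A.+-cong (p≋q l) (coeff--ᴳ q l)) (A.-‿inverseʳ _))

module GroupRingFacts {c ℓ} (A : CommutativeRing c ℓ) where
  open GroupRing A
  open GroupRingAlgebra A
  open CommutativeRing A renaming (Carrier to K)

  module _ {n : ℕ} where
    open IdealPowers A[ n ]-commutativeRing InI

    InPow⇒≈[] : ∀ {k} x y → InPow k (x -ᴳ y) → x ≈[ k ] y
    InPow⇒≈[] x y (ts , ts∈I , x-y≋ts) = ⟪ ts , ts∈I , ⟪ x-y≋ts ⟫ ⟫

    ≈[]⇒InPow : ∀ {k x y} → x ≈[ k ] y → InPow k (x -ᴳ y)
    ≈[]⇒InPow ⟪ ts , ts∈I , ⟪ x-y≋ts ⟫ ⟫ = ts , ts∈I , x-y≋ts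

    embed : K → A[ n ]
    embed a = (a , 0ᴸ) ∷ []

    embed-cong : ∀ {a b} → a ≈ b → embed a ≃ embed b
    embed-cong a≈b = ∷-cong a≈b ≃-refl

    embed-+ : ∀ a b → embed (a + b) ≃ embed a ++ embed b
    embed-+ a b = ⟪ go ⟫
      where
      go : ∀ l → coeff (embed (a + b)) l ≈ coeff (embed a ++ embed b) l
      go l with does (≡-dec ℤ._≟_ 0ᴸ l)
      ... | true = trans (+-identityʳ _) (+-congˡ (sym (+-identityʳ b)))
      ... | false = refl

    embed-0# : embed 0# ≃ []
    embed-0# = ⟪ go ⟫
      where
      go : ∀ l → coeff (embed 0#) l ≈ 0#
      go l with does (≡-dec ℤ._≟_ 0ᴸ l)
      ... | true = +-identityʳ _
      ... | false = refl

    embed-* : ∀ a b → embed a *ᴳ embed b ≃ embed (a * b)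
    embed-* a b = ≃-reflexive (≡.cong (λ l → (a * b , l) ∷ []) (⊕-identityˡ 0ᴸ))

    embed-*-δ : ∀ a (l : Lat n) → embed a *ᴳ δ l ≃ (a , l) ∷ []
    embed-*-δ a l = ≃-trans (∷-cong (*-identityʳ a) ≃-refl) (≃-reflexive (≡.cong (λ l → (a , l) ∷ []) (⊕-identityˡ l)))

    embed-ι : ∀ d → embed (ι d) ≃ d · oneᴳ
    embed-ι zero = embed-0#
    embed-ι (suc d) = ≃-trans (embed-+ 1# (ι d)) (++-cong ≃-refl (embed-ι d))

    embed-inverse-ι : ∀ {a} d → a * ι d ≈ 1# → embed a *ᴳ (d · oneᴳ) ≃ oneᴳ
    embed-inverse-ι {a} d a*d≈1 =
      ≃-trans (*ᴳ-cong (≃-refl {p = embed a}) (≃-sym (embed-ι d))) (≃-trans (embed-* a (ι d)) (embed-cong a*d≈1))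

    δ-⊕ : ∀ (u v : Lat n) → δ u *ᴳ δ v ≃ δ (u ⊕ v)
    δ-⊕ u v = ∷-cong (*-identityʳ 1#) ≃-refl

    δ-^ : ∀ k (u : Lat n) → δ u ^ k ≃ δ (k ·ᴸ u)
    δ-^ zero u = ≃-refl
    δ-^ (suc k) u = ≃-trans (*ᴳ-cong (≃-refl {p = δ u}) (δ-^ k u)) (δ-⊕ u (k ·ᴸ u))

    δ≈[1]1 : ∀ u → δ u ≈[ 1 ] oneᴳ
    δ≈[1]1 u = ⟪ ∈I⇒∈I^1 (trans (+-congˡ (+-identityʳ _)) (-‿inverseʳ 1#)) ⟫

  module Push {n m : ℕ} (φ : Lat n → Lat m) (hom : IsHom φ) where
    open IsHomProperties φ hom using (φ-0ᴸ)
    module Iⁿ = IdealPowers A[ n ]-commutativeRing InI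
    module Iᵐ = IdealPowers A[ m ]-commutativeRing InI
    open LinearExtension A A[ m ]-commutativeRing embed embed-cong embed-+ (λ l → δ (φ l))
      using (linear; linear-cong)

    push-++ : ∀ (p q : A[ n ]) → push φ (p ++ q) ≡ push φ p ++ push φ q
    push-++ p q = List.map-++ _ p q

    push--ᴳ : ∀ (p : A[ n ]) → push φ (-ᴳ p) ≡ -ᴳ push φ p
    push--ᴳ [] = ≡.refl
    push--ᴳ (t ∷ p) = ≡.cong (_ ∷_) (push--ᴳ p)

    push-map-·ᵗ : ∀ a l (q : A[ n ]) → push φ (List.map ((a , l) ·ᵗ_) q) ≡ List.map ((a , φ l) ·ᵗ_) (push φ q)
    push-map-·ᵗ a l [] = ≡.refl
    push-map-·ᵗ a l ((b , l′) ∷ q) = ≡.cong₂ _∷_ (≡.cong (a * b ,_) (hom l l′)) (push-map-·ᵗ a l q)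

    push-*ᴳ : ∀ (p q : A[ n ]) → push φ (p *ᴳ q) ≡ push φ p *ᴳ push φ q
    push-*ᴳ [] q = ≡.refl
    push-*ᴳ ((a , l) ∷ p) q = ≡.trans (push-++ (List.map ((a , l) ·ᵗ_) q) (p *ᴳ q))
      (≡.cong₂ _++_ (push-map-·ᵗ a l q) (push-*ᴳ p q))

    push-oneᴳ : push φ oneᴳ ≡ oneᴳ
    push-oneᴳ = ≡.cong (λ v → (1# , v) ∷ []) φ-0ᴸ

    push-embed : ∀ a → push φ (embed a) ≡ embed a
    push-embed a = ≡.cong (λ v → (a , v) ∷ []) φ-0ᴸ

    push-^ : ∀ p j → push φ (p Iⁿ.^ j) ≡ push φ p Iᵐ.^ j
    push-^ p zero = push-oneᴳ
    push-^ p (suc j) = ≡.trans (push-*ᴳ p (p Iⁿ.^ j)) (≡.cong (push φ p *ᴳ_) (push-^ p j))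

    push-prod : ∀ {k} (fs : Vec (A[ n ]) k) → push φ (Iⁿ.prod fs) ≡ Iᵐ.prod (Vec.map (push φ) fs)
    push-prod [] = push-oneᴳ
    push-prod (f ∷ fs) = ≡.trans (push-*ᴳ f (Iⁿ.prod fs)) (≡.cong (push φ f *ᴳ_) (push-prod fs))

    ε-push : ∀ (p : A[ n ]) → ε (push φ p) ≡ ε p
    ε-push [] = ≡.refl
    ε-push ((a , l) ∷ p) = ≡.cong (λ s → a + s) (ε-push p)

    push-All-InI : ∀ {k} (fs : Vec (A[ n ]) k) → VAll.All InI fs → VAll.All InI (Vec.map (push φ) fs)
    push-All-InI [] VAll.[] = VAll.[]
    push-All-InI (f ∷ fs) (f∈I VAll.∷ fs∈I) = ≡.subst (_≈ 0#) (≡.sym (ε-push f)) f∈I VAll.∷ push-All-InI fs fs∈I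

    push≃linear : ∀ (p : A[ n ]) → push φ p ≃ linear p
    push≃linear [] = ≃-refl
    push≃linear ((a , l) ∷ p) = ++-cong (≃-sym (embed-*-δ a (φ l))) (push≃linear p)

    push-cong : ∀ {p q : A[ n ]} → p ≃ q → push φ p ≃ push φ q
    push-cong {p} {q} p≃q = ≃-trans (push≃linear p) (≃-trans (linear-cong p≃q) (≃-sym (push≃linear q)))

    push-∈I^ : ∀ {k x} → x Iⁿ.∈I^ k → push φ x Iᵐ.∈I^ k
    push-∈I^ {k} = Iⁿ.∈I^-elim (λ x → push φ x Iᵐ.∈I^ k) (λ x≃y → Iᵐ.∈I^-resp-≈ (push-cong x≃y)) Iᵐ.0#∈I^
      (λ {x} {y} px py → Iᵐ.∈I^-resp-≈ (≃-reflexive (≡.sym (push-++ x y))) (Iᵐ.+-closed px py))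
      (λ r fs fs∈I → Iᵐ.∈I^-resp-≈ (≃-reflexive (≡.sym (≡.trans (push-*ᴳ r (Iⁿ.prod fs)) (≡.cong (push φ r *ᴳ_) (push-prod fs)))))
                                   (Iᵐ.monomial∈I^ (push φ r) (Vec.map (push φ) fs) (push-All-InI fs fs∈I)))

    push-≈[] : ∀ {k x y} → x Iⁿ.≈[ k ] y → push φ x Iᵐ.≈[ k ] push φ y
    push-≈[] {x = x} {y} Iⁿ.⟪ x-y ⟫ = Iᵐ.⟪ Iᵐ.∈I^-resp-≈ (≃-reflexive push-x-y) (push-∈I^ x-y) ⟫
      where
      push-x-y : push φ (x ++ (-ᴳ y)) ≡ push φ x ++ (-ᴳ push φ y)
      push-x-y = ≡.trans (push-++ x (-ᴳ y)) (≡.cong (push φ x ++_) (push--ᴳ y))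

module Isogeny {c ℓ} (A : CommutativeRing c ℓ) {n m : ℕ} (φ : Lat n → Lat m) (hom : IsHom φ)
  (inj : IsInjective φ) {d : ℕ} (cc : CokernelCard φ d) (d-invertible : GroupRing.Invertible A (GroupRing.ι A d))
  where
  open GroupRing A
  open GroupRingAlgebra A
  open GroupRingFacts A
  open CommutativeRing A using (_≈_; _*_; _+_) renaming (Carrier to K)
  open IsHomProperties φ hom using (φ-·ᴸ)
  open CosetCounting φ hom cc using (index·ᴸ-∈-image)
  open Push φ hom
  private
    module Rⁿ = CommutativeRing A[ n ]-commutativeRing
    module Sⁿ = ℤ-Solver A[ n ]-commutativeRing

  module Reasoningⁿ (k : ℕ) = Relation.Binary.Reasoning.Setoid (Iⁿ.≈[]-setoid k)
  module Reasoningᵐ (k : ℕ) = Relation.Binary.Reasoning.Setoid (Iᵐ.≈[]-setoid k)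

  module Rootsⁿ = Iⁿ.DthRoots (embed (proj₁ d-invertible)) d (embed-inverse-ι d (proj₂ d-invertible))
  module Rootsᵐ = Iᵐ.DthRoots (embed (proj₁ d-invertible)) d (embed-inverse-ι d (proj₂ d-invertible))

  lift : Lat m → Lat n
  lift w = proj₁ (index·ᴸ-∈-image w)

  φ-lift : ∀ w → φ (lift w) ≡ d ·ᴸ w
  φ-lift w = proj₂ (index·ᴸ-∈-image w)

  lift-⊕ : ∀ w w′ → lift (w ⊕ w′) ≡ lift w ⊕ lift w′
  lift-⊕ w w′ = inj _ _ (begin
    φ (lift (w ⊕ w′))             ≡⟨ φ-lift (w ⊕ w′) ⟩
    d ·ᴸ (w ⊕ w′)                 ≡⟨ ×-distrib-+ w w′ d ⟩
    (d ·ᴸ w) ⊕ (d ·ᴸ w′)          ≡⟨ ≡.cong₂ _⊕_ (≡.sym (φ-lift w)) (≡.sym (φ-lift w′)) ⟩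
    φ (lift w) ⊕ φ (lift w′)      ≡⟨ ≡.sym (hom (lift w) (lift w′)) ⟩
    φ (lift w ⊕ lift w′)          ∎)
    where open ≡.≡-Reasoning

  lift-φ : ∀ u → lift (φ u) ≡ d ·ᴸ u
  lift-φ u = inj _ _ (≡.trans (φ-lift (φ u)) (≡.sym (φ-·ᴸ d u)))

  root-spec : ∀ k w → Σ (A[ n ]) λ r → r Iⁿ.≈[ 1 ] oneᴳ × r Iⁿ.^ d Iⁿ.≈[ suc k ] δ (lift w)
  root-spec k w = Rootsⁿ.^d-surjective (δ≈[1]1 (lift w)) k

  root : ℕ → Lat m → A[ n ]
  root k w = proj₁ (root-spec k w)

  root≈[1]1 : ∀ k w → root k w Iⁿ.≈[ 1 ] oneᴳ
  root≈[1]1 k w = proj₁ (proj₂ (root-spec k w))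

  root-^d : ∀ k w → root k w Iⁿ.^ d Iⁿ.≈[ k ] δ (lift w)
  root-^d k w = Iⁿ.≈[]-antitone (ℕ.n≤1+n k) (proj₂ (proj₂ (root-spec k w)))

  root-⊕ : ∀ k w w′ → root k (w ⊕ w′) Iⁿ.≈[ k ] root k w *ᴳ root k w′
  root-⊕ k w w′ = Rootsⁿ.^d-injective (root≈[1]1 k (w ⊕ w′))
    (Iⁿ.≈[]-trans (Iⁿ.≈[]-* (root≈[1]1 k w) (root≈[1]1 k w′)) (Iⁿ.≈[]-reflexive (*ᴳ-identityˡ oneᴳ)))
    (begin
      root k (w ⊕ w′) Iⁿ.^ d                      ≈⟨ root-^d k (w ⊕ w′) ⟩
      δ (lift (w ⊕ w′))                           ≈⟨ Iⁿ.≈[]-reflexive (≃-reflexive (≡.cong δ (lift-⊕ w w′))) ⟩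
      δ (lift w ⊕ lift w′)                        ≈⟨ Iⁿ.≈[]-reflexive (≃-sym (δ-⊕ (lift w) (lift w′))) ⟩
      δ (lift w) *ᴳ δ (lift w′)                   ≈⟨ Iⁿ.≈[]-sym (Iⁿ.≈[]-* (root-^d k w) (root-^d k w′)) ⟩
      (root k w Iⁿ.^ d) *ᴳ (root k w′ Iⁿ.^ d)     ≈⟨ Iⁿ.≈[]-reflexive (≃-sym (^-distrib-* (root k w) (root k w′) d)) ⟩
      (root k w *ᴳ root k w′) Iⁿ.^ d              ∎)
    where
    open Reasoningⁿ k
    open import Algebra.Properties.CommutativeSemiring.Exp Rⁿ.commutativeSemiring using (^-distrib-*)

  root-φ : ∀ k u → root k (φ u) Iⁿ.≈[ k ] δ u
  root-φ k u = Rootsⁿ.^d-injective (root≈[1]1 k (φ u)) (δ≈[1]1 u)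
    (begin
      root k (φ u) Iⁿ.^ d      ≈⟨ root-^d k (φ u) ⟩
      δ (lift (φ u))           ≈⟨ Iⁿ.≈[]-reflexive (≃-reflexive (≡.cong δ (lift-φ u))) ⟩
      δ (d ·ᴸ u)               ≈⟨ Iⁿ.≈[]-reflexive (≃-sym (δ-^ d u)) ⟩
      δ u Iⁿ.^ d               ∎)
    where open Reasoningⁿ k

  -- ψ k sends δ_w to the d-th root of δ_(lift w) modulo Iᵏ, a stand-in for δ_(φ⁻¹ w).
  module Inverse (k : ℕ) where
    open LinearExtension A A[ n ]-commutativeRing embed embed-cong embed-+ (root k) public using ()
      renaming (linear to ψ; linear-++ to ψ-++; linear--ᴳ to ψ--ᴳ; linear-cong to ψ-cong)

    ψ-map-·ᵗ : ∀ a w (q : A[ m ]) → ψ (List.map ((a , w) ·ᵗ_) q) Iⁿ.≈[ k ] (embed a *ᴳ root k w) *ᴳ ψ q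
    ψ-map-·ᵗ a w [] = Iⁿ.≈[]-reflexive (≃-reflexive (≡.sym (*ᴳ-zeroʳ (embed a *ᴳ root k w))))
    ψ-map-·ᵗ a w ((a′ , w′) ∷ q) = begin
      embed (a * a′) *ᴳ root k (w ⊕ w′) ++ ψ (List.map ((a , w) ·ᵗ_) q)
        ≈⟨ Iⁿ.≈[]-+ (Iⁿ.≈[]-* (Iⁿ.≈[]-reflexive (≃-sym (embed-* a a′))) (root-⊕ k w w′)) (ψ-map-·ᵗ a w q) ⟩
      (embed a *ᴳ embed a′) *ᴳ (root k w *ᴳ root k w′) ++ (embed a *ᴳ root k w) *ᴳ ψ q
        ≈⟨ Iⁿ.≈[]-reflexive (factor (embed a) (embed a′) (root k w) (root k w′) (ψ q)) ⟩
      (embed a *ᴳ root k w) *ᴳ (embed a′ *ᴳ root k w′ ++ ψ q)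
        ∎
      where
      open Reasoningⁿ k
      factor : ∀ x x′ r r′ y → (x *ᴳ x′) *ᴳ (r *ᴳ r′) ++ (x *ᴳ r) *ᴳ y ≃ (x *ᴳ r) *ᴳ (x′ *ᴳ r′ ++ y)
      factor = Sⁿ.solve 5 (λ x x′ r r′ y → (x Sⁿ.:* x′) Sⁿ.:* (r Sⁿ.:* r′) Sⁿ.:+ (x Sⁿ.:* r) Sⁿ.:* y
                                          Sⁿ.:= (x Sⁿ.:* r) Sⁿ.:* (x′ Sⁿ.:* r′ Sⁿ.:+ y)) Rⁿ.refl

    ψ-*ᴳ : ∀ (p q : A[ m ]) → ψ (p *ᴳ q) Iⁿ.≈[ k ] ψ p *ᴳ ψ q
    ψ-*ᴳ [] q = Iⁿ.≈[]-refl
    ψ-*ᴳ ((a , w) ∷ p) q = begin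
      ψ (List.map ((a , w) ·ᵗ_) q ++ p *ᴳ q)                 ≈⟨ Iⁿ.≈[]-reflexive (ψ-++ (List.map ((a , w) ·ᵗ_) q) (p *ᴳ q)) ⟩
      ψ (List.map ((a , w) ·ᵗ_) q) ++ ψ (p *ᴳ q)             ≈⟨ Iⁿ.≈[]-+ (ψ-map-·ᵗ a w q) (ψ-*ᴳ p q) ⟩
      (embed a *ᴳ root k w) *ᴳ ψ q ++ ψ p *ᴳ ψ q             ≈⟨ Iⁿ.≈[]-reflexive (Rⁿ.sym (Rⁿ.distribʳ (ψ q) (embed a *ᴳ root k w) (ψ p))) ⟩
      (embed a *ᴳ root k w ++ ψ p) *ᴳ ψ q                    ∎
      where open Reasoningⁿ k

    ψ-ε : ∀ (f : A[ m ]) → ψ f Iⁿ.≈[ 1 ] embed (ε f)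
    ψ-ε [] = Iⁿ.≈[]-reflexive (≃-sym embed-0#)
    ψ-ε ((a , w) ∷ f) = Iⁿ.≈[]-trans
      (Iⁿ.≈[]-+ (Iⁿ.≈[]-trans (Iⁿ.≈[]-* (Iⁿ.≈[]-refl {x = embed a}) (root≈[1]1 k w)) (Iⁿ.≈[]-reflexive (Rⁿ.*-identityʳ (embed a))))
                (ψ-ε f))
      (Iⁿ.≈[]-reflexive (≃-sym (embed-+ a (ε f))))

    ψ-InI : ∀ (f : A[ m ]) → InI f → ψ f Iⁿ.∈I^ 1
    ψ-InI f f∈I = Iⁿ.≈[]-∈I^ (Iⁿ.≈[]-trans (ψ-ε f) (Iⁿ.≈[]-reflexive (≃-trans (embed-cong f∈I) embed-0#))) ℕ.≤-refl Iⁿ.0#∈I^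

    ψ-prod : ∀ {j} (fs : Vec (A[ m ]) j) → VAll.All InI fs → j ≤ k → ψ (Iᵐ.prod fs) Iⁿ.∈I^ j
    ψ-prod [] VAll.[] _ = Iⁿ.∈I^0 _
    ψ-prod {suc j} (f ∷ fs) (f∈I VAll.∷ fs∈I) j<k = Iⁿ.≈[]-∈I^ (ψ-*ᴳ f (Iᵐ.prod fs)) j<k
      (Iⁿ.*-closed (ψ-InI f f∈I) (ψ-prod fs fs∈I (ℕ.≤-trans (ℕ.n≤1+n j) j<k)))

    ψ-∈I^ : ∀ {v} → v Iᵐ.∈I^ k → ψ v Iⁿ.∈I^ k
    ψ-∈I^ = Iᵐ.∈I^-elim (λ v → ψ v Iⁿ.∈I^ k) (λ v≃v′ → Iⁿ.∈I^-resp-≈ (ψ-cong v≃v′)) Iⁿ.0#∈I^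
      (λ {v} {v′} ψv ψv′ → Iⁿ.∈I^-resp-≈ (Rⁿ.sym (ψ-++ v v′)) (Iⁿ.+-closed ψv ψv′))
      (λ r fs fs∈I → Iⁿ.≈[]-∈I^ (ψ-*ᴳ r (Iᵐ.prod fs)) ℕ.≤-refl (Iⁿ.*ˡ-closed (ψ r) (ψ-prod fs fs∈I ℕ.≤-refl)))

    ψ-≈[] : ∀ {v v′} → v Iᵐ.≈[ k ] v′ → ψ v Iⁿ.≈[ k ] ψ v′
    ψ-≈[] {v} {v′} Iᵐ.⟪ v-v′ ⟫ =
      Iⁿ.⟪ Iⁿ.∈I^-resp-≈ (Rⁿ.trans (ψ-++ v (-ᴳ v′)) (Rⁿ.+-congˡ (ψ--ᴳ v′))) (ψ-∈I^ v-v′) ⟫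

    ψ-push : ∀ (p : A[ n ]) → ψ (push φ p) Iⁿ.≈[ k ] p
    ψ-push [] = Iⁿ.≈[]-refl
    ψ-push ((a , l) ∷ p) = Iⁿ.≈[]-trans
      (Iⁿ.≈[]-+ (Iⁿ.≈[]-* (Iⁿ.≈[]-refl {x = embed a}) (root-φ k l)) (ψ-push p))
      (Iⁿ.≈[]-reflexive (++-cong (embed-*-δ a l) ≃-refl))

    push-root : ∀ w → push φ (root k w) Iᵐ.≈[ k ] δ w
    push-root w = Rootsᵐ.^d-injective
      (Iᵐ.≈[]-trans (push-≈[] (root≈[1]1 k w)) (Iᵐ.≈[]-reflexive (≃-reflexive push-oneᴳ)))
      (δ≈[1]1 w)
      (begin
        push φ (root k w) Iᵐ.^ d      ≈⟨ Iᵐ.≈[]-reflexive (≃-reflexive (≡.sym (push-^ (root k w) d))) ⟩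
        push φ (root k w Iⁿ.^ d)      ≈⟨ push-≈[] (root-^d k w) ⟩
        δ (φ (lift w))                ≈⟨ Iᵐ.≈[]-reflexive (≃-reflexive (≡.cong δ (φ-lift w))) ⟩
        δ (d ·ᴸ w)                    ≈⟨ Iᵐ.≈[]-reflexive (≃-sym (δ-^ d w)) ⟩
        δ w Iᵐ.^ d                    ∎)
      where open Reasoningᵐ k

    push-ψ : ∀ (v : A[ m ]) → push φ (ψ v) Iᵐ.≈[ k ] v
    push-ψ [] = Iᵐ.≈[]-refl
    push-ψ ((a , w) ∷ v) = begin
      push φ (embed a *ᴳ root k w ++ ψ v)               ≈⟨ Iᵐ.≈[]-reflexive (≃-reflexive push-distributes) ⟩
      embed a *ᴳ push φ (root k w) ++ push φ (ψ v)      ≈⟨ Iᵐ.≈[]-+ (Iᵐ.≈[]-* (Iᵐ.≈[]-refl {x = embed a}) (push-root w)) (push-ψ v) ⟩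
      embed a *ᴳ δ w ++ v                               ≈⟨ Iᵐ.≈[]-reflexive (++-cong (embed-*-δ a w) ≃-refl) ⟩
      (a , w) ∷ v                                       ∎
      where
      open Reasoningᵐ k
      push-distributes : push φ (embed a *ᴳ root k w ++ ψ v) ≡ embed a *ᴳ push φ (root k w) ++ push φ (ψ v)
      push-distributes = ≡.trans (push-++ (embed a *ᴳ root k w) (ψ v))
        (≡.cong (_++ push φ (ψ v)) (≡.trans (push-*ᴳ (embed a) (root k w)) (≡.cong (_*ᴳ push φ (root k w)) (push-embed a))))

  push-reflects-≈[] : ∀ k {x y} → push φ x Iᵐ.≈[ k ] push φ y → x Iⁿ.≈[ k ] y
  push-reflects-≈[] k {x} {y} push-x≈push-y = begin
    x                       ≈⟨ Iⁿ.≈[]-sym (ψ-push x) ⟩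
    ψ (push φ x)            ≈⟨ ψ-≈[] push-x≈push-y ⟩
    ψ (push φ y)            ≈⟨ ψ-push y ⟩
    y                       ∎
    where
    open Inverse k
    open Reasoningⁿ k

  φR-injective : φR-Injective φ
  φR-injective x y push-x≈push-y k = ≈[]⇒InPow (push-reflects-≈[] k (InPow⇒≈[] (push φ (seq x k)) (push φ (seq y k)) (push-x≈push-y k)))

  φR-surjective : φR-Surjective φ
  φR-surjective y = x , λ k → ≈[]⇒InPow (Inverse.push-ψ k (seq y k))
    where
    xₖ : ℕ → A[ n ]
    xₖ k = Inverse.ψ k (seq y k)
    push-xₖ-compat : ∀ k k′ → k ≤ k′ → push φ (xₖ k′) Iᵐ.≈[ k ] push φ (xₖ k)
    push-xₖ-compat k k′ k≤k′ = begin
      push φ (xₖ k′)          ≈⟨ Iᵐ.≈[]-antitone k≤k′ (Inverse.push-ψ k′ (seq y k′)) ⟩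
      seq y k′                ≈⟨ InPow⇒≈[] (seq y k′) (seq y k) (compat y k k′ k≤k′) ⟩
      seq y k                 ≈⟨ Iᵐ.≈[]-sym (Inverse.push-ψ k (seq y k)) ⟩
      push φ (xₖ k)           ∎
      where open Reasoningᵐ k
    x : R n
    x = record { seq = xₖ ; compat = λ k k′ k≤k′ → ≈[]⇒InPow (push-reflects-≈[] k (push-xₖ-compat k k′ k≤k′)) }

proposition1p5 : ∀ {c ℓ} (A : CommutativeRing c ℓ) {n m : ℕ} (φ : Lat n → Lat m)
    → IsHom φ → IsInjective φ
    → (d : ℕ) → CokernelCard φ d
    → GroupRing.Invertible A (GroupRing.ι A d)
    → GroupRing.φR-Injective A φ × GroupRing.φR-Surjective A φ
proposition1p5 A φ hom inj d cc d-invertible = φR-injective , φR-surjective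
  where open Isogeny A φ hom inj cc d-invertible
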